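{- Let $k\ge 3$ and $m\ge 4$, and let $p,q$ be integers with $1\le p\le q-2$ and $p+q=m-2$. Then $\sigma\big(\widetilde{C}^k_2(p+1,q-1)\big)>\sigma\big(\widetilde{C}^k_2(p,q)\big)$.
   Context: A hypergraph has a finite vertex set and a family of subsets (edges); it is $k$-uniform if all edges have $k$ vertices. A path is an alternating sequence $(v_0,e_1,v_1,\dots,e_p,v_p)$ with all vertices distinct, all edges distinct and $v_{i-1},v_i\in e_i$; its length is $p$. The distance $d(u,v)$ is the length of a shortest path, and the transmission $\sigma(G)$ is the sum of $d(u,v)$ over all unordered pairs of distinct vertices. Attaching a pendant path of length $r\ge 1$ at a vertex $w$ means adding new edges $f_1,\dots,f_r$ where $f_i=\{x_{i-1}\}\cup Y_i$ with $x_0=w$, each $Y_i$ a set of $k-1$ new vertices, the sets $Y_1,\dots,Y_r$ pairwise disjoint, and $x_i\in Y_i$; attaching a path of length $0$ means adding nothing. For integers $a,b\ge 0$, $\widetilde{C}^k_2(a,b)$ is the $k$-uniform hypergraph obtained from the two edges $e=\{u,v,w_1,\dots,w_{k-2}\}$ and $f=\{u,v,w'_1,\dots,w'_{k-2}\}$ (with all listed vertices distinct) by attaching a pendant path of length $a$ at $w_1$ and a pendant path of length $b$ at $w'_1$ (the two attached paths using disjoint sets of new vertices). It has size $a+b+2$. -}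

module Defs where

open import Data.Nat using (ℕ; zero; suc; _+_; _*_; _∸_; _≤_; _<_)
open import Data.List using (List; []; _∷_; _++_; map; length; upTo; concat)
open import Data.List.Membership.Propositional using (_∈_)
open import Data.List.Relation.Unary.All using (All)
open import Data.List.Relation.Unary.Unique.Propositional using (Unique)
open import Data.Fin using (Fin)
open import Data.List using (lookup)
open import Data.Product using (Σ; _×_; _,_)
open import Data.Empty using (⊥)
open import Relation.Binary.PropositionalEquality using (_≡_)

-- A finite hypergraph: vertex set {0, …, order-1}, edges given as a list
-- of vertex lists (each list read as a set of vertices).
record Hypergraph : Set where
  constructor hg
  field
    order : ℕ
    edges : List (List ℕ)
open Hypergraph public

Chain : ℕ → ℕ → List ℕ → List (List ℕ) → Set
Chain x y []       []       = x ≡ y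
Chain x y (z ∷ zs) (e ∷ es) = x ∈ e × z ∈ e × Chain z y zs es
Chain x y []       (_ ∷ _)  = ⊥
Chain x y (_ ∷ _)  []       = ⊥

IsPath : (H : Hypergraph) → ℕ → ℕ → ℕ → Set
IsPath H u v p =
  Σ (List ℕ) λ zs → Σ (List (Fin (length (edges H)))) λ es →
    length es ≡ p
    × Unique (u ∷ zs)
    × Unique es
    × All (λ x → x < order H) (u ∷ zs)
    × Chain u v zs (map (lookup (edges H)) es)

IsDistance : Hypergraph → ℕ → ℕ → ℕ → Set
IsDistance H u v d = IsPath H u v d × (∀ p → IsPath H u v p → d ≤ p)

rowSum : ℕ → (ℕ → ℕ) → ℕ
rowSum zero    g = 0
rowSum (suc n) g = rowSum n g + g n

pairSum : ℕ → (ℕ → ℕ → ℕ) → ℕ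
pairSum zero    d = 0
pairSum (suc n) d = pairSum n d + rowSum n (λ u → d u n)

IsTransmission : Hypergraph → ℕ → Set
IsTransmission H s =
  Σ (ℕ → ℕ → ℕ) λ d →
    (∀ u v → u < v → v < order H → IsDistance H u v (d u v))
    × s ≡ pairSum (order H) d

block : ℕ → ℕ → List ℕ
block s l = map (s +_) (upTo l)

-- Pendant path of length r attached at w, new vertices from `base` on,
-- in blocks Yᵢ of size k-1, xᵢ = first vertex of Yᵢ.
-- Edge fᵢ₊₁ = {xᵢ} ∪ Y_{i+1}, with x₀ = w.
pendant : (k w base r : ℕ) → List (List ℕ)
pendant k w base r = map edge (upTo r)
  where
    prev : ℕ → ℕ
    prev zero    = w
    prev (suc i) = base + i * (k ∸ 1)
    edge : ℕ → List ℕ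
    edge i = prev i ∷ block (base + i * (k ∸ 1)) (k ∸ 1)

-- C̃^k_2(a,b): u = 0, v = 1, e = {0,1,2,…,k-1} (w₁ = 2),
-- f = {0,1,k,…,2k-3} (w'₁ = k); pendant path of length a at w₁ using
-- vertices 2k-2, …, 2k-3+a(k-1); pendant path of length b at w'₁ using
-- the next b(k-1) vertices.
Ctilde : (k a b : ℕ) → Hypergraph
Ctilde k a b = hg n
  ( (0 ∷ 1 ∷ block 2 (k ∸ 2))
  ∷ (0 ∷ 1 ∷ block k (k ∸ 2))
  ∷ (pendant k 2 baseA a ++ pendant k k baseB b))
  where
    baseA = 2 * k ∸ 2
    baseB = baseA + a * (k ∸ 1)
    n = baseB + b * (k ∸ 1)

-- Both hypergraphs are hyperpaths: their edges line up as E₀, …, E_len (the pendant path at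
-- w₁ reversed, then e, f and the pendant path at w′₁), each vertex lying in one edge or in two
-- consecutive ones.  Along such a spine d(x, y) is one more than the number of cuts c (between
-- E_c and E_{c+1}) separating x from y, so σ = C(n, 2) + Σ_c L_c R_c, where L_c and R_c count
-- the vertices entirely left and right of cut c.  In C̃^k_2(a, b) each cut is crossed by a single
-- vertex except the cut between e and f, crossed by u and v; hence L_c = (c + 1)(k − 1) − [a ≤ c]
-- and R_c = n − (c + 1)(k − 1) − [c ≤ a].  Passing from (p, q) to (p + 1, q − 1) changes only
-- the terms at c = p and c = p + 1, and raises the sum by R_p − L_{p+1} > 0 since p + 2 ≤ q.

module Submission where

open import Defs
open import Data.Empty using (⊥-elim)
open import Data.Fin using (Fin)
open import Data.List using (List; []; _∷_; length; map; lookup; _++_; replicate)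
open import Data.List.Membership.Propositional using (_∈_)
open import Data.List.Membership.Propositional.Properties
  using (∈-lookup; ∈-map⁺; ∈-map⁻; ∈-upTo⁺; ∈-upTo⁻; ∈-++⁺ˡ; ∈-++⁺ʳ; ∈-++⁻)
open import Data.List.Properties using (length-map; length-++; length-replicate; map-++)
open import Data.List.Relation.Unary.All as All using (All; []; _∷_)
open import Data.List.Relation.Unary.All.Properties using (++⁺; replicate⁺)
open import Data.List.Relation.Unary.AllPairs using ([]; _∷_)
open import Data.List.Relation.Unary.Any using (here; there; index)
open import Data.List.Relation.Unary.Any.Properties using (lookup-index)
open import Data.List.Relation.Unary.Unique.Propositional using (Unique)
open import Data.Nat using (ℕ; zero; suc; _+_; _*_; _∸_; _≤_; _<_; _≤′_; ≤′-refl; ≤′-step; z≤n; s≤s; _⊓_; pred)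
open import Data.Nat.DivMod using (_/_; _%_; m≡m%n+[m/n]*n; m%n<n; m<n*o⇒m/o<n)
open import Data.Nat.ListAction using (sum)
open import Data.Nat.ListAction.Properties using (sum-++)
open import Data.Nat.Properties
open import Algebra.Properties.CommutativeSemigroup +-commutativeSemigroup using (interchange)
open import Data.Nat.Tactic.RingSolver using (solve-∀)
open import Data.Product using (Σ; ∃; _×_; _,_; proj₁; proj₂)
open import Data.Sum using (inj₁; inj₂)
open import Data.Unit using (⊤; tt)
open import Function using (_∘_)
open import Relation.Binary.Definitions using (tri<; tri≈; tri>)
open import Relation.Binary.PropositionalEquality
open import Relation.Nullary using (yes; no)

-- Indicators and finite sums

⟦_≤_⟧ : ℕ → ℕ → ℕ
⟦ zero  ≤ c     ⟧ = 1
⟦ suc h ≤ zero  ⟧ = 0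
⟦ suc h ≤ suc c ⟧ = ⟦ h ≤ c ⟧

⟦_<_⟧ : ℕ → ℕ → ℕ
⟦ c < h ⟧ = ⟦ suc c ≤ h ⟧

⟦_≡_⟧ : ℕ → ℕ → ℕ
⟦ zero  ≡ zero  ⟧ = 1
⟦ zero  ≡ suc _ ⟧ = 0
⟦ suc _ ≡ zero  ⟧ = 0
⟦ suc x ≡ suc y ⟧ = ⟦ x ≡ y ⟧

⟦≤⟧-true : ∀ {x y} → x ≤ y → ⟦ x ≤ y ⟧ ≡ 1
⟦≤⟧-true z≤n     = refl
⟦≤⟧-true (s≤s p) = ⟦≤⟧-true p

⟦≤⟧-false : ∀ {x y} → y < x → ⟦ x ≤ y ⟧ ≡ 0
⟦≤⟧-false {suc x} {zero}  _       = refl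
⟦≤⟧-false {suc x} {suc y} (s≤s p) = ⟦≤⟧-false p

⟦≡⟧-false : ∀ {x y} → x ≢ y → ⟦ x ≡ y ⟧ ≡ 0
⟦≡⟧-false {zero}  {zero}  x≢y = ⊥-elim (x≢y refl)
⟦≡⟧-false {zero}  {suc y} x≢y = refl
⟦≡⟧-false {suc x} {zero}  x≢y = refl
⟦≡⟧-false {suc x} {suc y} x≢y = ⟦≡⟧-false (x≢y ∘ cong suc)

⟦≡⟧-sym : ∀ x y → ⟦ x ≡ y ⟧ ≡ ⟦ y ≡ x ⟧
⟦≡⟧-sym zero    zero    = refl
⟦≡⟧-sym zero    (suc y) = refl
⟦≡⟧-sym (suc x) zero    = refl
⟦≡⟧-sym (suc x) (suc y) = ⟦≡⟧-sym x y

⟦≤⟧≡⟦≡⟧+⟦<⟧ : ∀ x y → ⟦ x ≤ y ⟧ ≡ ⟦ x ≡ y ⟧ + ⟦ x < y ⟧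
⟦≤⟧≡⟦≡⟧+⟦<⟧ zero    zero    = refl
⟦≤⟧≡⟦≡⟧+⟦<⟧ zero    (suc y) = refl
⟦≤⟧≡⟦≡⟧+⟦<⟧ (suc x) zero    = refl
⟦≤⟧≡⟦≡⟧+⟦<⟧ (suc x) (suc y) = ⟦≤⟧≡⟦≡⟧+⟦<⟧ x y

⟦≤⟧+⟦>⟧≡1 : ∀ x y → ⟦ x ≤ y ⟧ + ⟦ y < x ⟧ ≡ 1
⟦≤⟧+⟦>⟧≡1 zero    zero    = refl
⟦≤⟧+⟦>⟧≡1 zero    (suc y) = refl
⟦≤⟧+⟦>⟧≡1 (suc x) zero    = refl
⟦≤⟧+⟦>⟧≡1 (suc x) (suc y) = ⟦≤⟧+⟦>⟧≡1 x y

⟦≤⟧+⟦≥⟧≡1+⟦≡⟧ : ∀ x y → ⟦ x ≤ y ⟧ + ⟦ y ≤ x ⟧ ≡ suc ⟦ x ≡ y ⟧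
⟦≤⟧+⟦≥⟧≡1+⟦≡⟧ x y = begin
  ⟦ x ≤ y ⟧ + ⟦ y ≤ x ⟧                  ≡⟨ cong (⟦ x ≤ y ⟧ +_) (⟦≤⟧≡⟦≡⟧+⟦<⟧ y x) ⟩
  ⟦ x ≤ y ⟧ + (⟦ y ≡ x ⟧ + ⟦ y < x ⟧)    ≡⟨ swap ⟦ x ≤ y ⟧ ⟦ y ≡ x ⟧ ⟦ y < x ⟧ ⟩
  ⟦ y ≡ x ⟧ + (⟦ x ≤ y ⟧ + ⟦ y < x ⟧)    ≡⟨ cong₂ _+_ (⟦≡⟧-sym y x) (⟦≤⟧+⟦>⟧≡1 x y) ⟩
  ⟦ x ≡ y ⟧ + 1                          ≡⟨ +-comm ⟦ x ≡ y ⟧ 1 ⟩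
  suc ⟦ x ≡ y ⟧                          ∎
  where
  open ≡-Reasoning
  swap : ∀ u v w → u + (v + w) ≡ v + (u + w)
  swap = solve-∀

⟦≤suc⟧ : ∀ h c → ⟦ h ≤ suc c ⟧ ≡ ⟦ h ≤ c ⟧ + ⟦ h ≡ suc c ⟧
⟦≤suc⟧ zero          c       = refl
⟦≤suc⟧ (suc zero)    zero    = refl
⟦≤suc⟧ (suc (suc h)) zero    = refl
⟦≤suc⟧ (suc h)       (suc c) = ⟦≤suc⟧ h c

⟦≤0⟧ : ∀ h → ⟦ h ≤ 0 ⟧ ≡ ⟦ h ≡ 0 ⟧
⟦≤0⟧ zero    = refl
⟦≤0⟧ (suc h) = refl

⟦≤⟧-skip : ∀ {a c} → a ≢ c → ⟦ a ≤ c ⟧ ≡ ⟦ suc a ≤ c ⟧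
⟦≤⟧-skip {a} {c} a≢c = trans (⟦≤⟧≡⟦≡⟧+⟦<⟧ a c) (cong (_+ ⟦ a < c ⟧) (⟦≡⟧-false a≢c))

⟦≤suc⟧-skip : ∀ {c a} → c ≢ suc a → ⟦ c ≤ suc a ⟧ ≡ ⟦ c ≤ a ⟧
⟦≤suc⟧-skip {c} {a} c≢1+a = trans (⟦≤suc⟧ c a) (trans (cong (⟦ c ≤ a ⟧ +_) (⟦≡⟧-false c≢1+a)) (+-identityʳ _))

⟦≤⟧*⟦>⟧≡0 : ∀ x c → ⟦ x ≤ c ⟧ * ⟦ c < x ⟧ ≡ 0
⟦≤⟧*⟦>⟧≡0 x c with x ≤? c
... | yes x≤c rewrite ⟦≤⟧-false (s≤s x≤c) = *-zeroʳ ⟦ x ≤ c ⟧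
... | no  x≰c rewrite ⟦≤⟧-false (≰⇒> x≰c) = refl

⟦≤⟧*⟦<suc⟧≡⟦≡⟧ : ∀ x c → ⟦ x ≤ c ⟧ * ⟦ c < suc x ⟧ ≡ ⟦ x ≡ c ⟧
⟦≤⟧*⟦<suc⟧≡⟦≡⟧ zero    zero    = refl
⟦≤⟧*⟦<suc⟧≡⟦≡⟧ zero    (suc c) = refl
⟦≤⟧*⟦<suc⟧≡⟦≡⟧ (suc x) zero    = refl
⟦≤⟧*⟦<suc⟧≡⟦≡⟧ (suc x) (suc c) = ⟦≤⟧*⟦<suc⟧≡⟦≡⟧ x c

rowSum-cong : ∀ n {f g : ℕ → ℕ} → (∀ i → i < n → f i ≡ g i) → rowSum n f ≡ rowSum n g
rowSum-cong zero    f≗g = refl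
rowSum-cong (suc n) f≗g = cong₂ _+_ (rowSum-cong n (λ i i<n → f≗g i (m<n⇒m<1+n i<n))) (f≗g n ≤-refl)

rowSum-const : ∀ n c → rowSum n (λ _ → c) ≡ n * c
rowSum-const zero    c = refl
rowSum-const (suc n) c rewrite rowSum-const n c = +-comm (n * c) c

rowSum-+ : ∀ n (f g : ℕ → ℕ) → rowSum n (λ i → f i + g i) ≡ rowSum n f + rowSum n g
rowSum-+ zero    f g = refl
rowSum-+ (suc n) f g rewrite rowSum-+ n f g = interchange (rowSum n f) (rowSum n g) (f n) (g n)

rowSum-suc : ∀ n (f : ℕ → ℕ) → rowSum (suc n) f ≡ f 0 + rowSum n (f ∘ suc)
rowSum-suc zero    f = +-comm 0 (f 0)
rowSum-suc (suc n) f rewrite rowSum-suc n f = +-assoc (f 0) (rowSum n (f ∘ suc)) (f (suc n))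

rowSum-*ˡ : ∀ n c (f : ℕ → ℕ) → rowSum n (λ i → c * f i) ≡ c * rowSum n f
rowSum-*ˡ zero    c f = sym (*-zeroʳ c)
rowSum-*ˡ (suc n) c f rewrite rowSum-*ˡ n c f = sym (*-distribˡ-+ c (rowSum n f) (f n))

rowSum-*ʳ : ∀ n c (f : ℕ → ℕ) → rowSum n (λ i → f i * c) ≡ rowSum n f * c
rowSum-*ʳ zero    c f = refl
rowSum-*ʳ (suc n) c f rewrite rowSum-*ʳ n c f = sym (*-distribʳ-+ c (rowSum n f) (f n))

rowSum-comm : ∀ n m (F : ℕ → ℕ → ℕ) →
              rowSum n (λ i → rowSum m (λ c → F c i)) ≡ rowSum m (λ c → rowSum n (F c))
rowSum-comm zero    m F = sym (trans (rowSum-const m 0) (*-zeroʳ m))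
rowSum-comm (suc n) m F rewrite rowSum-comm n m F =
  sym (rowSum-+ m (λ c → rowSum n (F c)) (λ c → F c n))

pairSum-+ : ∀ n (d e : ℕ → ℕ → ℕ) → pairSum n (λ u v → d u v + e u v) ≡ pairSum n d + pairSum n e
pairSum-+ zero    d e = refl
pairSum-+ (suc n) d e rewrite pairSum-+ n d e | rowSum-+ n (λ u → d u n) (λ u → e u n) =
  interchange (pairSum n d) (pairSum n e) (rowSum n (λ u → d u n)) (rowSum n (λ u → e u n))

pairSum-cong : ∀ n {d e : ℕ → ℕ → ℕ} → (∀ u v → d u v ≡ e u v) → pairSum n d ≡ pairSum n e
pairSum-cong zero    d≗e = refl
pairSum-cong (suc n) d≗e = cong₂ _+_ (pairSum-cong n d≗e) (rowSum-cong n (λ u _ → d≗e u n))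

pairSum-rowSum-comm : ∀ n m (F : ℕ → ℕ → ℕ → ℕ) →
                      pairSum n (λ u v → rowSum m (λ c → F c u v)) ≡ rowSum m (λ c → pairSum n (F c))
pairSum-rowSum-comm zero    m F = sym (trans (rowSum-const m 0) (*-zeroʳ m))
pairSum-rowSum-comm (suc n) m F rewrite pairSum-rowSum-comm n m F | rowSum-comm n m (λ c u → F c u n) =
  sym (rowSum-+ m (λ c → pairSum n (F c)) (λ c → rowSum n (λ u → F c u n)))

-- Σ_{u<v} (P u Q v + P v Q u) misses only the diagonal of (Σ P)(Σ Q), which vanishes.
pairSum-product : ∀ n (P Q : ℕ → ℕ) → (∀ x → P x * Q x ≡ 0) →
                  pairSum n (λ u v → P u * Q v + P v * Q u) ≡ rowSum n P * rowSum n Q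
pairSum-product zero    P Q PQ≡0 = refl
pairSum-product (suc n) P Q PQ≡0
  rewrite pairSum-product n P Q PQ≡0 | rowSum-+ n (λ u → P u * Q n) (λ u → P n * Q u)
        | rowSum-*ʳ n (Q n) P | rowSum-*ˡ n (P n) Q = begin
  ΣP * ΣQ + (ΣP * Q n + P n * ΣQ)               ≡⟨ sym (+-identityʳ _) ⟩
  ΣP * ΣQ + (ΣP * Q n + P n * ΣQ) + 0           ≡⟨ cong (ΣP * ΣQ + (ΣP * Q n + P n * ΣQ) +_) (sym (PQ≡0 n)) ⟩
  ΣP * ΣQ + (ΣP * Q n + P n * ΣQ) + P n * Q n   ≡⟨ expand ΣP ΣQ (P n) (Q n) ⟩
  (ΣP + P n) * (ΣQ + Q n)                       ∎
  where
  open ≡-Reasoning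
  ΣP = rowSum n P
  ΣQ = rowSum n Q
  expand : ∀ a b c d → a * b + (a * d + c * b) + c * d ≡ (a + c) * (b + d)
  expand = solve-∀

m∸h+⟦h≤m⟧≡1+m∸h : ∀ m h → (m ∸ h) + ⟦ h ≤ m ⟧ ≡ suc m ∸ h
m∸h+⟦h≤m⟧≡1+m∸h m       zero    = +-comm m 1
m∸h+⟦h≤m⟧≡1+m∸h zero    (suc h) = sym (0∸n≡0 h)
m∸h+⟦h≤m⟧≡1+m∸h (suc m) (suc h) = m∸h+⟦h≤m⟧≡1+m∸h m h

rowSum-⟦≤⟧*⟦<⟧ : ∀ m h l → rowSum m (λ c → ⟦ h ≤ c ⟧ * ⟦ c < l ⟧) ≡ (l ⊓ m) ∸ h
rowSum-⟦≤⟧*⟦<⟧ zero    h l rewrite ⊓-zeroʳ l = sym (0∸n≡0 h)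
rowSum-⟦≤⟧*⟦<⟧ (suc m) h l with suc m ≤? l
... | yes m<l rewrite rowSum-⟦≤⟧*⟦<⟧ m h l | ⟦≤⟧-true m<l | *-identityʳ ⟦ h ≤ m ⟧
                    | m≥n⇒m⊓n≡n (<⇒≤ m<l) | m≥n⇒m⊓n≡n m<l = m∸h+⟦h≤m⟧≡1+m∸h m h
... | no  m≮l rewrite rowSum-⟦≤⟧*⟦<⟧ m h l | ⟦≤⟧-false (≰⇒> m≮l) | *-zeroʳ ⟦ h ≤ m ⟧
                    | m≤n⇒m⊓n≡m (≤-pred (≰⇒> m≮l)) | m≤n⇒m⊓n≡m (<⇒≤ (≰⇒> m≮l)) = +-identityʳ _

rowSum-<-at-two : ∀ {m} a (f g : ℕ → ℕ) → 2 + a ≤′ m →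
                  (∀ c → c < m → c ≢ a → c ≢ suc a → f c ≡ g c) →
                  f a + f (suc a) < g a + g (suc a) → rowSum m f < rowSum m g
rowSum-<-at-two a f g ≤′-refl f≗g f<g
  rewrite +-assoc (rowSum a f) (f a) (f (suc a)) | +-assoc (rowSum a g) (g a) (g (suc a)) =
  +-mono-≤-< (≤-reflexive (rowSum-cong a agree)) f<g
  where
  agree : ∀ c → c < a → f c ≡ g c
  agree c c<a = f≗g c (m<n⇒m<1+n (m<n⇒m<1+n c<a)) (<⇒≢ c<a) (<⇒≢ (m<n⇒m<1+n c<a))
rowSum-<-at-two {suc m} a f g (≤′-step 2+a≤m) f≗g f<g =
  +-mono-<-≤ (rowSum-<-at-two a f g 2+a≤m (λ c c<m → f≗g c (m<n⇒m<1+n c<m)) f<g)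
             (≤-reflexive (f≗g m ≤-refl (>⇒≢ (<-trans (n<1+n a) 1+a<m)) (>⇒≢ 1+a<m)))
  where
  1+a<m : suc a < m
  1+a<m = ≤′⇒≤ 2+a≤m

-- Distances along a spine

2c+1<2c+2 : ∀ c → suc (c + c) < suc c + suc c
2c+1<2c+2 c = s≤s (≤-reflexive (sym (+-suc c c)))

2c+1<2c+3 : ∀ c → suc (c + c) < suc (suc c + suc c)
2c+1<2c+3 c = s≤s (s≤s (+-monoʳ-≤ c (n≤1+n c)))

-- H laid out as a hyperpath: its edges are E₀, …, E_len and each vertex z lies exactly in the
-- edges E_s with lo z ≤ s ≤ hi z, one edge or two consecutive ones.
record Spine (H : Hypergraph) : Set where
  field
    len   : ℕ
    edge  : ℕ → List ℕ
    lo hi : ℕ → ℕ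
    lo≤hi   : ∀ z → lo z ≤ hi z
    hi≤1+lo : ∀ z → hi z ≤ suc (lo z)
    hi≤len  : ∀ z → hi z ≤ len
    lo∈edge : ∀ z → z < order H → z ∈ edge (lo z)
    hi∈edge : ∀ z → z < order H → z ∈ edge (hi z)
    ∈edge⇒lo≤∧≤hi : ∀ s → s ≤ len → ∀ z → z ∈ edge s → lo z ≤ s × s ≤ hi z
    edge∈edges : ∀ s → s ≤ len → edge s ∈ edges H
    edges⊆spine : ∀ e → e ∈ edges H → ∃ λ s → s ≤ len × e ≡ edge s
    anchor      : ∀ s → s ≤ len → ∃ λ w → w < order H × lo w ≡ s
    joint       : ℕ → ℕ
    joint-spec  : ∀ c → c < len → joint c < order H × lo (joint c) ≡ c × hi (joint c) ≡ suc c

module SpineDistance {H : Hypergraph} (S : Spine H) where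

  open Spine S

  private
    n : ℕ
    n = order H

    EdgeId : Set
    EdgeId = Fin (length (edges H))

    edgeOf : EdgeId → List ℕ
    edgeOf = lookup (edges H)

  spineDistance : ℕ → ℕ → ℕ
  spineDistance x y = suc ((lo y ∸ hi x) + (lo x ∸ hi y))

  lo≤len : ∀ z → lo z ≤ len
  lo≤len z = ≤-trans (lo≤hi z) (hi≤len z)

  ∈edge-between : ∀ {z s} → z < n → lo z ≤ s → s ≤ hi z → z ∈ edge s
  ∈edge-between {z} {s} z<n lo≤s s≤hi with m≤n⇒m<n∨m≡n s≤hi
  ... | inj₂ refl = hi∈edge z z<n
  ... | inj₁ s<hi rewrite ≤-antisym (≤-pred (≤-trans s<hi (hi≤1+lo z))) lo≤s = lo∈edge z z<n

  shared-edge⇒lo≤hi : ∀ {e x z} → e ∈ edges H → x ∈ e → z ∈ e → lo z ≤ hi x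
  shared-edge⇒lo≤hi e∈ x∈ z∈ with edges⊆spine _ e∈
  ... | s , s≤len , refl = ≤-trans (proj₁ (∈edge⇒lo≤∧≤hi s s≤len _ z∈)) (proj₂ (∈edge⇒lo≤∧≤hi s s≤len _ x∈))


  chain-spread : ∀ {x y z zs e es} → All (_∈ edges H) (e ∷ es) → Chain x y (z ∷ zs) (e ∷ es) →
                 lo y ≤ hi x + length zs × lo x ≤ hi y + length zs
  chain-spread {x} {y} {z} {[]} {e} {[]} (e∈ ∷ []) (x∈ , y∈ , refl) =
    ≤-trans (shared-edge⇒lo≤hi e∈ x∈ y∈) (m≤m+n (hi x) 0) , ≤-trans (shared-edge⇒lo≤hi e∈ y∈ x∈) (m≤m+n (hi y) 0)
  chain-spread {x} {y} {z} {z′ ∷ zs} {e} {e′ ∷ es} (e∈ ∷ es∈) (x∈ , z∈ , chain) =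
    (begin
      lo y                   ≤⟨ proj₁ rest ⟩
      hi z + length zs       ≤⟨ +-monoˡ-≤ (length zs) (≤-trans (hi≤1+lo z) (s≤s (shared-edge⇒lo≤hi e∈ x∈ z∈))) ⟩
      suc (hi x) + length zs ≡⟨ sym (+-suc (hi x) (length zs)) ⟩
      hi x + suc (length zs) ∎) ,
    (begin
      lo x                   ≤⟨ shared-edge⇒lo≤hi e∈ z∈ x∈ ⟩
      hi z                   ≤⟨ hi≤1+lo z ⟩
      suc (lo z)             ≤⟨ s≤s (proj₂ rest) ⟩
      suc (hi y + length zs) ≡⟨ sym (+-suc (hi y) (length zs)) ⟩
      hi y + suc (length zs) ∎)
    where
    open ≤-Reasoning
    rest = chain-spread es∈ chain
  chain-spread {zs = []}    {es = _ ∷ _} _ (_ , _ , ())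
  chain-spread {zs = _ ∷ _} {es = []}    _ (_ , _ , ())

  chain-length : ∀ {x y zs es} → Chain x y zs es → length zs ≡ length es
  chain-length {zs = []}    {[]}    _                = refl
  chain-length {zs = _ ∷ _} {_ ∷ _} (_ , _ , chain) = cong suc (chain-length chain)
  chain-length {zs = []}    {_ ∷ _} ()
  chain-length {zs = _ ∷ _} {[]}    ()

  edgeOf∈edges : ∀ fs → All (_∈ edges H) (map edgeOf fs)
  edgeOf∈edges []       = []
  edgeOf∈edges (f ∷ fs) = ∈-lookup f ∷ edgeOf∈edges fs

  spineDistance-≤ : ∀ x y ℓ → lo y ≤ hi x + ℓ → lo x ≤ hi y + ℓ → spineDistance x y ≤ suc ℓ
  spineDistance-≤ x y ℓ ly≤ lx≤ with lo y ≤? hi x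
  ... | yes ly≤hx rewrite m≤n⇒m∸n≡0 ly≤hx = s≤s (m≤n+o⇒m∸n≤o (lo x) (hi y) lx≤)
  ... | no  ly≰hx rewrite m≤n⇒m∸n≡0 (≤-trans (lo≤hi x) (≤-trans (<⇒≤ (≰⇒> ly≰hx)) (lo≤hi y)))
                        | +-identityʳ (lo y ∸ hi x) = s≤s (m≤n+o⇒m∸n≤o (lo y) (hi x) ly≤)

  spineDistance-minimal : ∀ {x y p} → x ≢ y → IsPath H x y p → spineDistance x y ≤ p
  spineDistance-minimal x≢y (zs , [] , _ , _ , _ , _ , chain) with zs
  ... | []    = ⊥-elim (x≢y chain)
  ... | _ ∷ _ = ⊥-elim chain
  spineDistance-minimal {x} {y} x≢y (zs , f ∷ fs , refl , _ , _ , _ , chain) with zs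
  ... | []      = ⊥-elim chain
  ... | z ∷ zs′ with chain-spread (edgeOf∈edges (f ∷ fs)) chain
  ...   | ly≤ , lx≤ = subst (spineDistance x y ≤_) (cong suc length-zs′)
                            (spineDistance-≤ x y (length zs′) ly≤ lx≤)
    where
    length-zs′ : length zs′ ≡ length fs
    length-zs′ = trans (chain-length (proj₂ (proj₂ chain))) (length-map edgeOf fs)

  edgeId : ∀ s → s ≤ len → EdgeId
  edgeId s s≤len = index (edge∈edges s s≤len)

  ∈edgeId : ∀ {z s} (s≤len : s ≤ len) → z ∈ edge s → z ∈ edgeOf (edgeId s s≤len)
  ∈edgeId {z} s≤len = subst (z ∈_) (lookup-index (edge∈edges _ s≤len))

  spineIndex : EdgeId → ℕ
  spineIndex f = proj₁ (edges⊆spine (edgeOf f) (∈-lookup f))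

  edge-<⇒≢ : ∀ {s s′} → s < s′ → s′ ≤ len → edge s ≢ edge s′
  edge-<⇒≢ {s} {s′} s<s′ s′≤len eq with anchor s′ s′≤len
  ... | w , w<n , refl = <⇒≱ s<s′ (proj₁ (∈edge⇒lo≤∧≤hi s (≤-trans (<⇒≤ s<s′) s′≤len) w
                                           (subst (w ∈_) (sym eq) (lo∈edge w w<n))))

  edge-injective : ∀ {s s′} → s ≤ len → s′ ≤ len → edge s ≡ edge s′ → s ≡ s′
  edge-injective {s} {s′} s≤len s′≤len eq with <-cmp s s′
  ... | tri< s<s′ _ _ = ⊥-elim (edge-<⇒≢ s<s′ s′≤len eq)
  ... | tri≈ _ s≡s′ _ = s≡s′
  ... | tri> _ _ s′<s = ⊥-elim (edge-<⇒≢ s′<s s≤len (sym eq))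

  spineIndex-edgeId : ∀ s (s≤len : s ≤ len) → spineIndex (edgeId s s≤len) ≡ s
  spineIndex-edgeId s s≤len with edges⊆spine (edgeOf (edgeId s s≤len)) (∈-lookup (edgeId s s≤len))
  ... | s′ , s′≤len , eq = edge-injective s′≤len s≤len (trans (sym eq) (sym (lookup-index (edge∈edges s s≤len))))

  spineIndex-<⇒≢ : ∀ {f g} → spineIndex f < spineIndex g → f ≢ g
  spineIndex-<⇒≢ lt refl = <-irrefl refl lt

  -- Twice the midpoint of the spine interval of a vertex: it strictly increases along the
  -- routes built below, so they never revisit a vertex.
  pos : ℕ → ℕ
  pos z = lo z + hi z

  pos-<⇒≢ : ∀ {u v} → pos u < pos v → u ≢ v
  pos-<⇒≢ lt refl = <-irrefl refl lt

  pos≤2hi : ∀ z → pos z ≤ hi z + hi z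
  pos≤2hi z = +-monoˡ-≤ (hi z) (lo≤hi z)

  2lo≤pos : ∀ z → lo z + lo z ≤ pos z
  2lo≤pos z = +-monoʳ-≤ (lo z) (lo≤hi z)

  module _ {c} (c<len : c < len) where

    joint<n : joint c < n
    joint<n = proj₁ (joint-spec c c<len)

    joint∈edge : joint c ∈ edge c
    joint∈edge = subst (λ s → joint c ∈ edge s) (proj₁ (proj₂ (joint-spec c c<len))) (lo∈edge _ joint<n)

    joint∈next-edge : joint c ∈ edge (suc c)
    joint∈next-edge = subst (λ s → joint c ∈ edge s) (proj₂ (proj₂ (joint-spec c c<len))) (hi∈edge _ joint<n)

    pos-joint : pos (joint c) ≡ suc (c + c)
    pos-joint rewrite proj₁ (proj₂ (joint-spec c c<len)) | proj₂ (proj₂ (joint-spec c c<len)) = +-suc c c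

  -- IsPath H w y ℓ without the requirement that w avoid the later vertices, plus invariants
  -- V and F on the vertices and edges that make prepending a step safe.
  record Route (w y ℓ : ℕ) (V : ℕ → Set) (F : EdgeId → Set) : Set where
    field
      vertices        : List ℕ
      edgeIds         : List EdgeId
      length-edgeIds  : length edgeIds ≡ ℓ
      vertices-unique : Unique vertices
      edgeIds-unique  : Unique edgeIds
      vertices<n      : All (_< n) vertices
      vertices-V      : All V vertices
      edgeIds-F       : All F edgeIds
      chain           : Chain w y vertices (map edgeOf edgeIds)

  open Route

  prepend : ∀ {V F V′ F′ v y ℓ} w s (s≤len : s ≤ len) → w ∈ edge s → v ∈ edge s → v < n →
            (r : Route v y ℓ V F) →
            All (v ≢_) (vertices r) → All (edgeId s s≤len ≢_) (edgeIds r) →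
            All V′ (v ∷ vertices r) → All F′ (edgeId s s≤len ∷ edgeIds r) →
            Route w y (suc ℓ) V′ F′
  prepend w s s≤len w∈ v∈ v<n r v∉ e∉ V′s F′s = record
    { vertices        = _ ∷ vertices r
    ; edgeIds         = edgeId s s≤len ∷ edgeIds r
    ; length-edgeIds  = cong suc (length-edgeIds r)
    ; vertices-unique = v∉ ∷ vertices-unique r
    ; edgeIds-unique  = e∉ ∷ edgeIds-unique r
    ; vertices<n      = v<n ∷ vertices<n r
    ; vertices-V      = V′s
    ; edgeIds-F       = F′s
    ; chain           = ∈edgeId s≤len w∈ , ∈edgeId s≤len v∈ , chain r
    }

  route⇒path : ∀ {F w y ℓ} → w < n → Route w y ℓ (w ≢_) F → IsPath H w y ℓ
  route⇒path w<n r = vertices r , edgeIds r , length-edgeIds r , vertices-V r ∷ vertices-unique r ,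
                     edgeIds-unique r , w<n ∷ vertices<n r , chain r

  RightRoute : ℕ → ℕ → ℕ → Set
  RightRoute c y ℓ = Route (joint c) y ℓ (λ v → suc (c + c) < pos v) (λ f → suc c ≤ spineIndex f)

  LeftRoute : ℕ → ℕ → ℕ → Set
  LeftRoute c y ℓ = Route (joint c) y ℓ (λ v → pos v < suc (c + c)) (λ f → spineIndex f ≤ c)

  lo≡⇒<len : ∀ {y c L} → lo y ≡ suc (c + L) → c < len
  lo≡⇒<len {y} {c} {L} ly = ≤-trans (s≤s (m≤m+n c L)) (subst (_≤ len) ly (lo≤len y))

  rightRoute : ∀ {y} → y < n → ∀ c L → lo y ≡ suc (c + L) → RightRoute c y (suc L)
  rightRoute {y} y<n c zero ly = record
    { vertices        = y ∷ []
    ; edgeIds         = edgeId (suc c) c<len ∷ []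
    ; length-edgeIds  = refl
    ; vertices-unique = [] ∷ []
    ; edgeIds-unique  = [] ∷ []
    ; vertices<n      = y<n ∷ []
    ; vertices-V      = <-≤-trans (2c+1<2c+2 c) (subst (λ l → l + l ≤ pos y) ly′ (2lo≤pos y)) ∷ []
    ; edgeIds-F       = ≤-reflexive (sym (spineIndex-edgeId (suc c) c<len)) ∷ []
    ; chain           = ∈edgeId c<len (joint∈next-edge c<len) ,
                        ∈edgeId c<len (subst (λ s → y ∈ edge s) ly′ (lo∈edge y y<n)) , refl
    }
    where
    ly′ : lo y ≡ suc c
    ly′ = trans ly (cong suc (+-identityʳ c))
    c<len : c < len
    c<len = lo≡⇒<len ly
  rightRoute {y} y<n c (suc L) ly =
    prepend (joint c) (suc c) (<⇒≤ c+1<len) (joint∈next-edge (<-trans (n<1+n c) c+1<len))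
            (joint∈edge c+1<len) (joint<n c+1<len) r
            (All.map (λ {v} lt → pos-<⇒≢ (subst (_< pos v) (sym (pos-joint c+1<len)) lt)) (vertices-V r))
            (All.map (λ {f} lt → spineIndex-<⇒≢ (subst (_< spineIndex f) (sym index-c+1) lt)) (edgeIds-F r))
            (subst (suc (c + c) <_) (sym (pos-joint c+1<len)) (2c+1<2c+3 c) ∷
             All.map (<-trans (2c+1<2c+3 c)) (vertices-V r))
            (≤-reflexive (sym index-c+1) ∷ All.map (≤-trans (n≤1+n (suc c))) (edgeIds-F r))
    where
    ly′ : lo y ≡ suc (suc c + L)
    ly′ = trans ly (cong suc (+-suc c L))
    c+1<len : suc c < len
    c+1<len = lo≡⇒<len ly′
    r : RightRoute (suc c) y (suc L)
    r = rightRoute y<n (suc c) L ly′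
    index-c+1 : spineIndex (edgeId (suc c) (<⇒≤ c+1<len)) ≡ suc c
    index-c+1 = spineIndex-edgeId (suc c) (<⇒≤ c+1<len)

  leftRoute : ∀ {y} → y < n → ∀ L → L + hi y < len → LeftRoute (L + hi y) y (suc L)
  leftRoute {y} y<n zero c<len = record
    { vertices        = y ∷ []
    ; edgeIds         = edgeId (hi y) (hi≤len y) ∷ []
    ; length-edgeIds  = refl
    ; vertices-unique = [] ∷ []
    ; edgeIds-unique  = [] ∷ []
    ; vertices<n      = y<n ∷ []
    ; vertices-V      = s≤s (pos≤2hi y) ∷ []
    ; edgeIds-F       = ≤-reflexive (spineIndex-edgeId (hi y) (hi≤len y)) ∷ []
    ; chain           = ∈edgeId (hi≤len y) (joint∈edge c<len) , ∈edgeId (hi≤len y) (hi∈edge y y<n) , refl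
    }
  leftRoute {y} y<n (suc L) c+1<len =
    prepend (joint (suc c)) (suc c) (<⇒≤ c+1<len) (joint∈edge c+1<len)
            (joint∈next-edge c<len) (joint<n c<len) r
            (All.map (λ {v} lt → ≢-sym (pos-<⇒≢ (subst (pos v <_) (sym (pos-joint c<len)) lt))) (vertices-V r))
            (All.map (λ {f} le → ≢-sym (spineIndex-<⇒≢ (subst (spineIndex f <_) (sym index-c+1) (s≤s le))))
                     (edgeIds-F r))
            (subst (_< suc (suc c + suc c)) (sym (pos-joint c<len)) (2c+1<2c+3 c) ∷
             All.map (λ lt → <-trans lt (2c+1<2c+3 c)) (vertices-V r))
            (≤-reflexive index-c+1 ∷ All.map (λ le → ≤-trans le (n≤1+n c)) (edgeIds-F r))
    where
    c : ℕ
    c = L + hi y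
    c<len : c < len
    c<len = <-trans (n<1+n c) c+1<len
    r : LeftRoute c y (suc L)
    r = leftRoute y<n L c<len
    index-c+1 : spineIndex (edgeId (suc c) (<⇒≤ c+1<len)) ≡ suc c
    index-c+1 = spineIndex-edgeId (suc c) (<⇒≤ c+1<len)

  rightward-path : ∀ {x y} → x < n → y < n → hi x < lo y → IsPath H x y (spineDistance x y)
  rightward-path {x} {y} x<n y<n hx<ly = subst (IsPath H x y) (sym distance) (route⇒path x<n route)
    where
    c L : ℕ
    c = hi x
    L = lo y ∸ suc c
    ly : lo y ≡ suc (c + L)
    ly = sym (m+[n∸m]≡n hx<ly)
    c<len : c < len
    c<len = lo≡⇒<len ly
    r : RightRoute c y (suc L)
    r = rightRoute y<n c L ly
    x≺joint : pos x < pos (joint c)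
    x≺joint = subst (pos x <_) (sym (pos-joint c<len)) (s≤s (pos≤2hi x))
    route : Route x y (suc (suc L)) (x ≢_) (λ _ → ⊤)
    route = prepend x c (<⇒≤ c<len) (hi∈edge x x<n) (joint∈edge c<len) (joint<n c<len) r
              (All.map (λ {v} lt → pos-<⇒≢ (subst (_< pos v) (sym (pos-joint c<len)) lt)) (vertices-V r))
              (All.map (λ {f} le → spineIndex-<⇒≢ (subst (_< spineIndex f) (sym (spineIndex-edgeId c _)) le))
                       (edgeIds-F r))
              (pos-<⇒≢ x≺joint ∷ All.map (λ lt → pos-<⇒≢ (<-trans (s≤s (pos≤2hi x)) lt)) (vertices-V r))
              (All.universal (λ _ → tt) _)
    distance : spineDistance x y ≡ suc (suc L)
    distance = cong suc (begin
      (lo y ∸ c) + (lo x ∸ hi y) ≡⟨ cong₂ _+_ (cong (_∸ c) ly) (m≤n⇒m∸n≡0 lx≤hy) ⟩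
      (suc (c + L) ∸ c) + 0      ≡⟨ +-identityʳ _ ⟩
      suc (c + L) ∸ c            ≡⟨ cong (_∸ c) (sym (+-suc c L)) ⟩
      c + suc L ∸ c              ≡⟨ m+n∸m≡n c (suc L) ⟩
      suc L                      ∎)
      where
      open ≡-Reasoning
      lx≤hy : lo x ≤ hi y
      lx≤hy = ≤-trans (lo≤hi x) (≤-trans (<⇒≤ hx<ly) (lo≤hi y))

  leftward-path : ∀ {x y} → x < n → y < n → hi y < lo x → IsPath H x y (spineDistance x y)
  leftward-path {x} {y} x<n y<n hy<lx = subst (IsPath H x y) (sym distance) (route⇒path x<n route)
    where
    c L : ℕ
    L = lo x ∸ suc (hi y)
    c = L + hi y
    lx : lo x ≡ suc c
    lx = trans (sym (m∸n+n≡m hy<lx)) (+-suc L (hi y))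
    c<len : c < len
    c<len = subst (_≤ len) lx (lo≤len x)
    r : LeftRoute c y (suc L)
    r = leftRoute y<n L c<len
    joint≺x : pos (joint c) < pos x
    joint≺x = subst₂ _<_ (sym (pos-joint c<len)) refl
                (<-≤-trans (2c+1<2c+2 c) (subst (λ l → l + l ≤ pos x) lx (2lo≤pos x)))
    route : Route x y (suc (suc L)) (x ≢_) (λ _ → ⊤)
    route = prepend x (suc c) c<len (subst (λ s → x ∈ edge s) lx (lo∈edge x x<n))
              (joint∈next-edge c<len) (joint<n c<len) r
              (All.map (λ {v} lt → ≢-sym (pos-<⇒≢ (subst (pos v <_) (sym (pos-joint c<len)) lt))) (vertices-V r))
              (All.map (λ {f} le → ≢-sym (spineIndex-<⇒≢ (subst (spineIndex f <_)
                                                          (sym (spineIndex-edgeId (suc c) _)) (s≤s le))))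
                       (edgeIds-F r))
              (≢-sym (pos-<⇒≢ joint≺x) ∷
               All.map (λ lt → ≢-sym (pos-<⇒≢ (<-trans lt (subst (_< pos x) (pos-joint c<len) joint≺x))))
                       (vertices-V r))
              (All.universal (λ _ → tt) _)
    distance : spineDistance x y ≡ suc (suc L)
    distance = cong suc (begin
      (lo y ∸ hi x) + (lo x ∸ hi y) ≡⟨ cong₂ _+_ (m≤n⇒m∸n≡0 ly≤hx) (cong (_∸ hi y) lx) ⟩
      suc L + hi y ∸ hi y           ≡⟨ m+n∸n≡m (suc L) (hi y) ⟩
      suc L                         ∎)
      where
      open ≡-Reasoning
      ly≤hx : lo y ≤ hi x
      ly≤hx = ≤-trans (lo≤hi y) (≤-trans (<⇒≤ hy<lx) (lo≤hi x))

  shared-edge : ∀ {x y} → x < n → y < n → lo y ≤ hi x → lo x ≤ hi y →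
                ∃ λ s → s ≤ len × x ∈ edge s × y ∈ edge s
  shared-edge {x} {y} x<n y<n ly≤hx lx≤hy with ≤-total (hi x) (hi y)
  ... | inj₁ hx≤hy = hi x , hi≤len x , hi∈edge x x<n , ∈edge-between y<n ly≤hx hx≤hy
  ... | inj₂ hy≤hx = hi y , hi≤len y , ∈edge-between x<n lx≤hy hy≤hx , hi∈edge y y<n

  adjacent-path : ∀ {x y} → x ≢ y → x < n → y < n → lo y ≤ hi x → lo x ≤ hi y →
                  IsPath H x y (spineDistance x y)
  adjacent-path {x} {y} x≢y x<n y<n ly≤hx lx≤hy with shared-edge x<n y<n ly≤hx lx≤hy
  ... | s , s≤len , x∈ , y∈ =
    y ∷ [] , edgeId s s≤len ∷ [] , sym distance , (x≢y ∷ []) ∷ [] ∷ [] , [] ∷ [] ,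
    x<n ∷ y<n ∷ [] , ∈edgeId s≤len x∈ , ∈edgeId s≤len y∈ , refl
    where
    distance : spineDistance x y ≡ 1
    distance rewrite m≤n⇒m∸n≡0 ly≤hx | m≤n⇒m∸n≡0 lx≤hy = refl

  spineDistance-isDistance : ∀ {x y} → x ≢ y → x < n → y < n → IsDistance H x y (spineDistance x y)
  spineDistance-isDistance {x} {y} x≢y x<n y<n = path , λ _ → spineDistance-minimal x≢y
    where
    path : IsPath H x y (spineDistance x y)
    path with hi x <? lo y | hi y <? lo x
    ... | yes hx<ly | _         = rightward-path x<n y<n hx<ly
    ... | no  hx≮ly | yes hy<lx = leftward-path x<n y<n hy<lx
    ... | no  hx≮ly | no  hy≮lx = adjacent-path x≢y x<n y<n (≮⇒≥ hx≮ly) (≮⇒≥ hy≮lx)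

  spineDistance-cuts : ∀ x y → spineDistance x y ≡
    suc (rowSum len (λ c → ⟦ hi x ≤ c ⟧ * ⟦ c < lo y ⟧ + ⟦ hi y ≤ c ⟧ * ⟦ c < lo x ⟧))
  spineDistance-cuts x y
    rewrite rowSum-+ len (λ c → ⟦ hi x ≤ c ⟧ * ⟦ c < lo y ⟧) (λ c → ⟦ hi y ≤ c ⟧ * ⟦ c < lo x ⟧)
          | rowSum-⟦≤⟧*⟦<⟧ len (hi x) (lo y) | rowSum-⟦≤⟧*⟦<⟧ len (hi y) (lo x)
          | m≤n⇒m⊓n≡m (lo≤len y) | m≤n⇒m⊓n≡m (lo≤len x) = refl

  spineDistance-transmission : IsTransmission H (pairSum n spineDistance)
  spineDistance-transmission =
    spineDistance , (λ u v u<v v<n → spineDistance-isDistance (<⇒≢ u<v) (<-trans u<v v<n) v<n) , refl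

  left right across : ℕ → ℕ
  left   c = rowSum n (λ x → ⟦ hi x ≤ c ⟧)
  right  c = rowSum n (λ x → ⟦ c < lo x ⟧)
  across c = rowSum n (λ x → ⟦ lo x ≤ c ⟧ * ⟦ c < hi x ⟧)

  transmission-formula : pairSum n spineDistance ≡ pairSum n (λ _ _ → 1) + rowSum len (λ c → left c * right c)
  transmission-formula = begin
    pairSum n spineDistance
      ≡⟨ pairSum-cong n spineDistance-cuts ⟩
    pairSum n (λ u v → 1 + rowSum len (λ c → cut c u v))
      ≡⟨ pairSum-+ n (λ _ _ → 1) _ ⟩
    pairSum n (λ _ _ → 1) + pairSum n (λ u v → rowSum len (λ c → cut c u v))
      ≡⟨ cong (pairSum n (λ _ _ → 1) +_) (pairSum-rowSum-comm n len cut) ⟩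
    pairSum n (λ _ _ → 1) + rowSum len (λ c → pairSum n (cut c))
      ≡⟨ cong (pairSum n (λ _ _ → 1) +_) (rowSum-cong len (λ c _ →
           pairSum-product n (λ x → ⟦ hi x ≤ c ⟧) (λ x → ⟦ c < lo x ⟧) (not-left-and-right c))) ⟩
    pairSum n (λ _ _ → 1) + rowSum len (λ c → left c * right c)
      ∎
    where
    open ≡-Reasoning
    cut : ℕ → ℕ → ℕ → ℕ
    cut c u v = ⟦ hi u ≤ c ⟧ * ⟦ c < lo v ⟧ + ⟦ hi v ≤ c ⟧ * ⟦ c < lo u ⟧
    not-left-and-right : ∀ c x → ⟦ hi x ≤ c ⟧ * ⟦ c < lo x ⟧ ≡ 0
    not-left-and-right c x with hi x ≤? c
    ... | yes hx≤c rewrite ⟦≤⟧-false (s≤s (≤-trans (lo≤hi x) hx≤c)) = *-zeroʳ ⟦ hi x ≤ c ⟧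
    ... | no  hx≰c rewrite ⟦≤⟧-false (≰⇒> hx≰c) = refl

  left+across+right : ∀ c → left c + across c + right c ≡ n
  left+across+right c = begin
    left c + across c + right c
      ≡⟨ cong (_+ right c) (sym (rowSum-+ n (λ x → ⟦ hi x ≤ c ⟧) _)) ⟩
    rowSum n (λ x → ⟦ hi x ≤ c ⟧ + ⟦ lo x ≤ c ⟧ * ⟦ c < hi x ⟧) + right c
      ≡⟨ sym (rowSum-+ n _ (λ x → ⟦ c < lo x ⟧)) ⟩
    rowSum n (λ x → ⟦ hi x ≤ c ⟧ + ⟦ lo x ≤ c ⟧ * ⟦ c < hi x ⟧ + ⟦ c < lo x ⟧)
      ≡⟨ rowSum-cong n (λ x _ → exactly-one x) ⟩
    rowSum n (λ _ → 1)
      ≡⟨ trans (rowSum-const n 1) (*-identityʳ n) ⟩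
    n ∎
    where
    open ≡-Reasoning
    exactly-one : ∀ x → ⟦ hi x ≤ c ⟧ + ⟦ lo x ≤ c ⟧ * ⟦ c < hi x ⟧ + ⟦ c < lo x ⟧ ≡ 1
    exactly-one x with hi x ≤? c
    ... | yes hx≤c rewrite ⟦≤⟧-true hx≤c | ⟦≤⟧-false (s≤s hx≤c) | ⟦≤⟧-false (s≤s (≤-trans (lo≤hi x) hx≤c))
                         | *-zeroʳ ⟦ lo x ≤ c ⟧ = refl
    ... | no  hx≰c rewrite ⟦≤⟧-false (≰⇒> hx≰c) | ⟦≤⟧-true (≰⇒> hx≰c) | *-identityʳ ⟦ lo x ≤ c ⟧ =
      ⟦≤⟧+⟦>⟧≡1 (lo x) c

-- Comparing cut profiles

-- The counts L c and R c of vertices entirely left and right of cut c in C̃^k_2(a, b), where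
-- T = k − 1 and the cut a, between e and f, is the one crossed by two vertices.
record CutProfile (len T a : ℕ) (L R : ℕ → ℕ) : Set where
  field
    left-eq  : ∀ c → c < len → L c + ⟦ a ≤ c ⟧ ≡ suc c * T
    right-eq : ∀ c → c < len → R c + ⟦ c ≤ a ⟧ + suc c * T ≡ suc len * T

-- The two profiles agree except at the cuts a and a + 1, where the second sum of products
-- gains R a − L (a + 1).
module CutComparison {len T′ a : ℕ} {L R L′ R′ : ℕ → ℕ}
                     (P : CutProfile len (suc T′) a L R) (P′ : CutProfile len (suc T′) (suc a) L′ R′) where

  open CutProfile

  private
    T : ℕ
    T = suc T′

  left-shift : ∀ c → c < len → L c + ⟦ a ≤ c ⟧ ≡ L′ c + ⟦ suc a ≤ c ⟧
  left-shift c c<len = trans (left-eq P c c<len) (sym (left-eq P′ c c<len))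

  right-shift : ∀ c → c < len → R c + ⟦ c ≤ a ⟧ ≡ R′ c + ⟦ c ≤ suc a ⟧
  right-shift c c<len = +-cancelʳ-≡ (suc c * T) _ _ (trans (right-eq P c c<len) (sym (right-eq P′ c c<len)))

  left-shift-at : ∀ {c i j} → c < len → ⟦ a ≤ c ⟧ ≡ i → ⟦ suc a ≤ c ⟧ ≡ j → L c + i ≡ L′ c + j
  left-shift-at {c} c<len refl refl = left-shift c c<len

  right-shift-at : ∀ {c i j} → c < len → ⟦ c ≤ a ⟧ ≡ i → ⟦ c ≤ suc a ⟧ ≡ j → R c + i ≡ R′ c + j
  right-shift-at {c} c<len refl refl = right-shift c c<len

  L≡L′ : ∀ c → c < len → c ≢ a → L c ≡ L′ c
  L≡L′ c c<len c≢a = +-cancelʳ-≡ ⟦ suc a ≤ c ⟧ (L c) (L′ c) (left-shift-at c<len (⟦≤⟧-skip (≢-sym c≢a)) refl)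

  R≡R′ : ∀ c → c < len → c ≢ suc a → R c ≡ R′ c
  R≡R′ c c<len c≢1+a = +-cancelʳ-≡ ⟦ c ≤ a ⟧ (R c) (R′ c) (right-shift-at c<len refl (⟦≤suc⟧-skip c≢1+a))

  module _ (room : a + (2 + a) < len) where

    1+a<len : suc a < len
    1+a<len = ≤-trans (m≤n+m (2 + a) a) (<⇒≤ room)

    a<len : a < len
    a<len = <-trans (n<1+n a) 1+a<len

    L′a≡1+La : L′ a ≡ suc (L a)
    L′a≡1+La = begin
      L′ a       ≡⟨ sym (+-identityʳ (L′ a)) ⟩
      L′ a + 0   ≡⟨ sym (left-shift-at a<len (⟦≤⟧-true (≤-refl {a})) (⟦≤⟧-false (n<1+n a))) ⟩
      L a + 1    ≡⟨ +-comm (L a) 1 ⟩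
      suc (L a)  ∎
      where open ≡-Reasoning

    R′a≡Ra : R′ a ≡ R a
    R′a≡Ra = +-cancelʳ-≡ 1 (R′ a) (R a) (sym (right-shift-at a<len (⟦≤⟧-true (≤-refl {a})) (⟦≤⟧-true (n≤1+n a))))

    L′1+a≡L1+a : L′ (suc a) ≡ L (suc a)
    L′1+a≡L1+a = +-cancelʳ-≡ 1 (L′ (suc a)) (L (suc a))
                   (sym (left-shift-at 1+a<len (⟦≤⟧-true (n≤1+n a)) (⟦≤⟧-true (≤-refl {suc a}))))

    R1+a≡1+R′1+a : R (suc a) ≡ suc (R′ (suc a))
    R1+a≡1+R′1+a = begin
      R (suc a)          ≡⟨ sym (+-identityʳ (R (suc a))) ⟩
      R (suc a) + 0      ≡⟨ right-shift-at 1+a<len (⟦≤⟧-false (n<1+n a)) (⟦≤⟧-true (≤-refl {suc a})) ⟩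
      R′ (suc a) + 1     ≡⟨ +-comm (R′ (suc a)) 1 ⟩
      suc (R′ (suc a))   ∎
      where open ≡-Reasoning

    L1+a<Ra : L (suc a) < R a
    L1+a<Ra = +-cancelʳ-< 1 (L (suc a)) (R a) (+-cancelʳ-< (suc a * T) (L (suc a) + 1) (R a + 1) (begin-strict
      L (suc a) + 1 + suc a * T             ≡⟨ cong (λ i → L (suc a) + i + suc a * T) (sym (⟦≤⟧-true (n≤1+n a))) ⟩
      L (suc a) + ⟦ a ≤ suc a ⟧ + suc a * T ≡⟨ cong (_+ suc a * T) (left-eq P (suc a) 1+a<len) ⟩
      (2 + a) * T + suc a * T               ≡⟨ sym (*-distribʳ-+ T (2 + a) (suc a)) ⟩
      (2 + a + suc a) * T                   <⟨ *-monoˡ-< T (s≤s (≤-trans (≤-reflexive (shape a)) room)) ⟩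
      suc len * T                           ≡⟨ sym (right-eq P a a<len) ⟩
      R a + ⟦ a ≤ a ⟧ + suc a * T           ≡⟨ cong (λ i → R a + i + suc a * T) (⟦≤⟧-true (≤-refl {a})) ⟩
      R a + 1 + suc a * T                   ∎))
      where
      open ≤-Reasoning
      shape : ∀ a → suc (suc a + suc a) ≡ suc (a + (2 + a))
      shape = solve-∀

    two-cuts : L a * R a + L (suc a) * R (suc a) < L′ a * R′ a + L′ (suc a) * R′ (suc a)
    two-cuts rewrite L′a≡1+La | R′a≡Ra | L′1+a≡L1+a | R1+a≡1+R′1+a =
      subst₂ _<_ (expand₁ (L a) (R a) (L (suc a)) (R′ (suc a))) (expand₂ (L a) (R a) (L (suc a)) (R′ (suc a)))
             (+-monoʳ-< (L a * R a + L (suc a) * R′ (suc a)) L1+a<Ra)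
      where
      expand₁ : ∀ x y z w → x * y + z * w + z ≡ x * y + z * suc w
      expand₁ = solve-∀
      expand₂ : ∀ x y z w → x * y + z * w + y ≡ suc x * y + z * w
      expand₂ = solve-∀

    Σcut-products-< : rowSum len (λ c → L c * R c) < rowSum len (λ c → L′ c * R′ c)
    Σcut-products-< = rowSum-<-at-two a _ _ (≤⇒≤′ 1+a<len)
      (λ c c<len c≢a c≢1+a → cong₂ _*_ (L≡L′ c c<len c≢a) (R≡R′ c c<len c≢1+a)) two-cuts

-- The spine of C̃^k_2(a, b)

∈block : ∀ s l {r} → r < l → s + r ∈ block s l
∈block s l r<l = ∈-map⁺ (s +_) (∈-upTo⁺ r<l)

∈block⁻ : ∀ s l {z} → z ∈ block s l → ∃ λ r → r < l × z ≡ s + r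
∈block⁻ s l z∈ with ∈-map⁻ (s +_) z∈
... | r , r∈ , refl = r , ∈-upTo⁻ r∈ , refl

split< : ∀ {i m} → i < m → m ≡ i + suc (m ∸ suc i)
split< {i} i<m = trans (sym (m+[n∸m]≡n i<m)) (sym (+-suc i _))

split⇒< : ∀ {i m s} → m ≡ i + suc s → i < m
split⇒< {i} {s = s} refl = ≤-trans (s≤s (m≤m+n i s)) (≤-reflexive (sym (+-suc i s)))

sum-map-++ : ∀ {A : Set} (g : A → ℕ) xs ys → sum (map g (xs ++ ys)) ≡ sum (map g xs) + sum (map g ys)
sum-map-++ g xs ys = trans (cong sum (map-++ g xs ys)) (sum-++ (map g xs) (map g ys))

sum-map-replicate : ∀ {A : Set} (g : A → ℕ) m x → sum (map g (replicate m x)) ≡ m * g x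
sum-map-replicate g zero    x = refl
sum-map-replicate g (suc m) x = cong (g x +_) (sum-map-replicate g m x)

Interval : Set
Interval = ℕ × ℕ

entry : List Interval → ℕ → Interval
entry []       _       = 0 , 0
entry (p ∷ ps) zero    = p
entry (p ∷ ps) (suc i) = entry ps i

entry-++ʳ : ∀ ps qs j → entry (ps ++ qs) (length ps + j) ≡ entry qs j
entry-++ʳ []       qs j = refl
entry-++ʳ (p ∷ ps) qs j = entry-++ʳ ps qs j

entry-++ˡ : ∀ ps qs {j} → j < length ps → entry (ps ++ qs) j ≡ entry ps j
entry-++ˡ (p ∷ ps) qs {zero}  _         = refl
entry-++ˡ (p ∷ ps) qs {suc j} (s≤s j<) = entry-++ˡ ps qs j<

entry-replicate : ∀ m p {j} → j < m → entry (replicate m p) j ≡ p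
entry-replicate (suc m) p {zero}  _         = refl
entry-replicate (suc m) p {suc j} (s≤s j<) = entry-replicate m p j<

rowSum-entry : ∀ ps (g : Interval → ℕ) → rowSum (length ps) (g ∘ entry ps) ≡ sum (map g ps)
rowSum-entry []       g = refl
rowSum-entry (p ∷ ps) g = trans (rowSum-suc (length ps) (g ∘ entry (p ∷ ps))) (cong (g p +_) (rowSum-entry ps g))

module CtildeSpine (t a′ b′ : ℕ) where

  k T a b : ℕ
  k = 3 + t
  T = 2 + t
  a = suc a′
  b = suc b′

  H : Hypergraph
  H = Ctilde k a b

  baseA baseB : ℕ
  baseA = 2 * k ∸ 2
  baseB = baseA + a * T

  headA : ℕ → ℕ
  headA zero    = 2
  headA (suc i) = baseA + i * T

  headB : ℕ → ℕ
  headB zero    = k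
  headB (suc j) = baseB + j * T

  pendantA pendantB : ℕ → List ℕ
  pendantA i = headA i ∷ block (baseA + i * T) T
  pendantB j = headB j ∷ block (baseB + j * T) T

  edgeE edgeF : List ℕ
  edgeE = 0 ∷ 1 ∷ block 2 (suc t)
  edgeF = 0 ∷ 1 ∷ block k (suc t)

  pendantA∈ : ∀ {i} → i < a → pendantA i ∈ pendant k 2 baseA a
  pendantA∈ {zero}  i<a = ∈-map⁺ _ (∈-upTo⁺ i<a)
  pendantA∈ {suc i} i<a = ∈-map⁺ _ (∈-upTo⁺ i<a)

  pendantA∈⁻ : ∀ {e} → e ∈ pendant k 2 baseA a → ∃ λ i → i < a × e ≡ pendantA i
  pendantA∈⁻ e∈ with ∈-map⁻ _ e∈
  ... | zero  , i∈ , eq = zero  , ∈-upTo⁻ i∈ , eq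
  ... | suc i , i∈ , eq = suc i , ∈-upTo⁻ i∈ , eq

  pendantB∈ : ∀ {j} → j < b → pendantB j ∈ pendant k k baseB b
  pendantB∈ {zero}  j<b = ∈-map⁺ _ (∈-upTo⁺ j<b)
  pendantB∈ {suc j} j<b = ∈-map⁺ _ (∈-upTo⁺ j<b)

  pendantB∈⁻ : ∀ {e} → e ∈ pendant k k baseB b → ∃ λ j → j < b × e ≡ pendantB j
  pendantB∈⁻ e∈ with ∈-map⁻ _ e∈
  ... | zero  , j∈ , eq = zero  , ∈-upTo⁻ j∈ , eq
  ... | suc j , j∈ , eq = suc j , ∈-upTo⁻ j∈ , eq

  -- Spine edge a − 1 − i is pendantA i, spine edge a is e, spine edge a + 1 is f and spine
  -- edge a + 2 + j is pendantB j.  The interval tables below list (lo, hi) vertex by vertex: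
  -- u, v, w₁, the rest of e, w′₁, the rest of f, then the blocks Y_i of the two pendant paths,
  -- whose first vertex also lies in the next pendant edge unless it ends the path.
  intervalsF : List Interval
  intervalsF = (suc a , suc (suc a)) ∷ replicate t (suc a , suc a)

  frontIntervals : List Interval
  frontIntervals = (a , suc a) ∷ (a , suc a) ∷ (a′ , a) ∷ replicate t (a , a) ++ intervalsF

  blockA : ℕ → List Interval
  blockA s = (pred s , s) ∷ replicate (suc t) (s , s)

  blocksA : ℕ → List Interval
  blocksA zero    = []
  blocksA (suc s) = blockA s ++ blocksA s

  firstB : ℕ → ℕ → Interval
  firstB s zero    = s , s
  firstB s (suc _) = s , suc s

  blockB : ℕ → ℕ → List Interval
  blockB s r = firstB s r ∷ replicate (suc t) (s , s)

  blocksB : ℕ → ℕ → List Interval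
  blocksB s zero    = []
  blocksB s (suc r) = blockB s r ++ blocksB (suc s) r

  intervals : List Interval
  intervals = frontIntervals ++ blocksA a ++ blocksB (2 + a) b

  lo hi : ℕ → ℕ
  lo z = proj₁ (entry intervals z)
  hi z = proj₂ (entry intervals z)

  len : ℕ
  len = suc (a + b)

  n : ℕ
  n = order H

  baseA≡ : baseA ≡ 3 + (t + suc t)
  baseA≡ = front-size t
    where
    front-size : ∀ t → suc (t + (3 + t + 0)) ≡ 3 + (t + suc t)
    front-size = solve-∀

  length-front : length frontIntervals ≡ baseA
  length-front = trans (cong (3 +_) (trans (length-++ (replicate t (a , a)))
                                           (cong₂ _+_ (length-replicate t) (cong suc (length-replicate t)))))
                       (sym baseA≡)

  length-blockA : ∀ s → length (blockA s) ≡ T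
  length-blockA s = cong (2 +_) (length-replicate t)

  length-blockB : ∀ s r → length (blockB s r) ≡ T
  length-blockB s r = cong (2 +_) (length-replicate t)

  length-blocksA : ∀ m → length (blocksA m) ≡ m * T
  length-blocksA zero    = refl
  length-blocksA (suc m) = trans (length-++ (blockA m)) (cong₂ _+_ (length-blockA m) (length-blocksA m))

  length-blocksB : ∀ s m → length (blocksB s m) ≡ m * T
  length-blocksB s zero    = refl
  length-blocksB s (suc m) =
    trans (length-++ (blockB s m)) (cong₂ _+_ (length-blockB s m) (length-blocksB (suc s) m))

  block-offset< : ∀ {i m r} → i < m → r < T → i * T + r < m * T
  block-offset< {i} {m} i<m r<T =
    <-≤-trans (+-monoʳ-< (i * T) r<T) (≤-trans (≤-reflexive (+-comm (i * T) T)) (*-monoˡ-≤ T i<m))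

  entry-blocksA : ∀ i s {r} → r < T → entry (blocksA (i + suc s)) (i * T + r) ≡ entry (blockA s) r
  entry-blocksA zero    s {r} r<T = entry-++ˡ (blockA s) (blocksA s) (subst (r <_) (sym (length-blockA s)) r<T)
  entry-blocksA (suc i) s {r} r<T = begin
    entry (blockA (i + suc s) ++ blocksA (i + suc s)) (T + i * T + r)
      ≡⟨ cong (entry (blockA (i + suc s) ++ blocksA (i + suc s))) shift ⟩
    entry (blockA (i + suc s) ++ blocksA (i + suc s)) (length (blockA (i + suc s)) + (i * T + r))
      ≡⟨ entry-++ʳ (blockA (i + suc s)) (blocksA (i + suc s)) (i * T + r) ⟩
    entry (blocksA (i + suc s)) (i * T + r)
      ≡⟨ entry-blocksA i s r<T ⟩
    entry (blockA s) r ∎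
    where
    open ≡-Reasoning
    shift : T + i * T + r ≡ length (blockA (i + suc s)) + (i * T + r)
    shift = trans (+-assoc T (i * T) r) (cong (_+ (i * T + r)) (sym (length-blockA (i + suc s))))

  entry-blocksB : ∀ j s r′ {r} → r < T → entry (blocksB s (j + suc r′)) (j * T + r) ≡ entry (blockB (j + s) r′) r
  entry-blocksB zero    s r′ {r} r<T =
    entry-++ˡ (blockB s r′) (blocksB (suc s) r′) (subst (r <_) (sym (length-blockB s r′)) r<T)
  entry-blocksB (suc j) s r′ {r} r<T = begin
    entry (blockB s (j + suc r′) ++ blocksB (suc s) (j + suc r′)) (T + j * T + r)
      ≡⟨ cong (entry (blockB s (j + suc r′) ++ blocksB (suc s) (j + suc r′))) shift ⟩
    entry (blockB s (j + suc r′) ++ blocksB (suc s) (j + suc r′)) (length (blockB s (j + suc r′)) + (j * T + r))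
      ≡⟨ entry-++ʳ (blockB s (j + suc r′)) (blocksB (suc s) (j + suc r′)) (j * T + r) ⟩
    entry (blocksB (suc s) (j + suc r′)) (j * T + r)
      ≡⟨ entry-blocksB j (suc s) r′ r<T ⟩
    entry (blockB (j + suc s) r′) r
      ≡⟨ cong (λ s′ → entry (blockB s′ r′) r) (+-suc j s) ⟩
    entry (blockB (suc j + s) r′) r ∎
    where
    open ≡-Reasoning
    shift : T + j * T + r ≡ length (blockB s (j + suc r′)) + (j * T + r)
    shift = trans (+-assoc T (j * T) r) (cong (_+ (j * T + r)) (sym (length-blockB s (j + suc r′))))

  entry-front : ∀ {z} → z < baseA → entry intervals z ≡ entry frontIntervals z
  entry-front {z} z< = entry-++ˡ frontIntervals _ (subst (z <_) (sym length-front) z<)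

  entry-A : ∀ i s {r} → a ≡ i + suc s → r < T → entry intervals (baseA + i * T + r) ≡ entry (blockA s) r
  entry-A i s {r} a≡ r<T = begin
    entry intervals (baseA + i * T + r)
      ≡⟨ cong (entry intervals) (trans (+-assoc baseA (i * T) r) (cong (_+ (i * T + r)) (sym length-front))) ⟩
    entry intervals (length frontIntervals + (i * T + r))
      ≡⟨ entry-++ʳ frontIntervals _ (i * T + r) ⟩
    entry (blocksA a ++ blocksB (2 + a) b) (i * T + r)
      ≡⟨ entry-++ˡ (blocksA a) _ (subst (i * T + r <_) (sym (length-blocksA a)) (block-offset< i<a r<T)) ⟩
    entry (blocksA a) (i * T + r)
      ≡⟨ cong (λ m → entry (blocksA m) (i * T + r)) a≡ ⟩
    entry (blocksA (i + suc s)) (i * T + r)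
      ≡⟨ entry-blocksA i s r<T ⟩
    entry (blockA s) r ∎
    where
    open ≡-Reasoning
    i<a : i < a
    i<a = subst (i <_) (sym a≡) (≤-trans (s≤s (m≤m+n i s)) (≤-reflexive (sym (+-suc i s))))

  entry-B : ∀ j r′ {r} → b ≡ j + suc r′ → r < T →
            entry intervals (baseB + j * T + r) ≡ entry (blockB (j + (2 + a)) r′) r
  entry-B j r′ {r} b≡ r<T = begin
    entry intervals (baseB + j * T + r)
      ≡⟨ cong (entry intervals) shift ⟩
    entry intervals (length frontIntervals + (length (blocksA a) + (j * T + r)))
      ≡⟨ entry-++ʳ frontIntervals _ _ ⟩
    entry (blocksA a ++ blocksB (2 + a) b) (length (blocksA a) + (j * T + r))
      ≡⟨ entry-++ʳ (blocksA a) _ _ ⟩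
    entry (blocksB (2 + a) b) (j * T + r)
      ≡⟨ cong (λ m → entry (blocksB (2 + a) m) (j * T + r)) b≡ ⟩
    entry (blocksB (2 + a) (j + suc r′)) (j * T + r)
      ≡⟨ entry-blocksB j (2 + a) r′ r<T ⟩
    entry (blockB (j + (2 + a)) r′) r ∎
    where
    open ≡-Reasoning
    shift : baseB + j * T + r ≡ length frontIntervals + (length (blocksA a) + (j * T + r))
    shift = trans (+-assoc baseB (j * T) r) (trans (+-assoc baseA (a * T) (j * T + r))
              (cong₂ (λ u v → u + (v + (j * T + r))) (sym length-front) (sym (length-blocksA a))))

  entry-restE : ∀ {r} → r < t → entry intervals (3 + r) ≡ (a , a)
  entry-restE {r} r<t = begin
    entry intervals (3 + r)
      ≡⟨ entry-front (subst (3 + r <_) (sym baseA≡) (s≤s (s≤s (s≤s (≤-trans r<t (m≤m+n t (suc t))))))) ⟩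
    entry (replicate t (a , a) ++ intervalsF) r
      ≡⟨ entry-++ˡ (replicate t (a , a)) intervalsF (subst (r <_) (sym (length-replicate t)) r<t) ⟩
    entry (replicate t (a , a)) r
      ≡⟨ entry-replicate t (a , a) r<t ⟩
    (a , a) ∎
    where open ≡-Reasoning

  entry-w′₁ : entry intervals k ≡ (suc a , suc (suc a))
  entry-w′₁ = begin
    entry intervals (3 + t)
      ≡⟨ entry-front (subst (3 + t <_) (sym baseA≡) (s≤s (s≤s (s≤s (m<m+n t (s≤s z≤n)))))) ⟩
    entry (replicate t (a , a) ++ intervalsF) t
      ≡⟨ cong (entry (replicate t (a , a) ++ intervalsF))
              (trans (sym (+-identityʳ t)) (cong (_+ 0) (sym (length-replicate t)))) ⟩
    entry (replicate t (a , a) ++ intervalsF) (length (replicate t (a , a)) + 0)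
      ≡⟨ entry-++ʳ (replicate t (a , a)) intervalsF 0 ⟩
    (suc a , suc (suc a)) ∎
    where open ≡-Reasoning

  entry-restF : ∀ {r} → r < t → entry intervals (k + suc r) ≡ (suc a , suc a)
  entry-restF {r} r<t = begin
    entry intervals (3 + (t + suc r))
      ≡⟨ entry-front (subst (3 + (t + suc r) <_) (sym baseA≡) (s≤s (s≤s (s≤s (+-monoʳ-< t (s≤s r<t)))))) ⟩
    entry (replicate t (a , a) ++ intervalsF) (t + suc r)
      ≡⟨ cong (λ l → entry (replicate t (a , a) ++ intervalsF) (l + suc r)) (sym (length-replicate t)) ⟩
    entry (replicate t (a , a) ++ intervalsF) (length (replicate t (a , a)) + suc r)
      ≡⟨ entry-++ʳ (replicate t (a , a)) intervalsF (suc r) ⟩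
    entry (replicate t (suc a , suc a)) r
      ≡⟨ entry-replicate t (suc a , suc a) r<t ⟩
    (suc a , suc a) ∎
    where open ≡-Reasoning

  data Kind : ℕ → Set where
    isU      : Kind 0
    isV      : Kind 1
    isW₁     : Kind 2
    inRestE  : ∀ {r} → r < t → Kind (3 + r)
    isW′₁    : Kind k
    inRestF  : ∀ {r} → r < t → Kind (k + suc r)
    inBlockA : ∀ {i s r} → a ≡ i + suc s → r < T → Kind (baseA + i * T + r)
    inBlockB : ∀ {j r′ r} → b ≡ j + suc r′ → r < T → Kind (baseB + j * T + r)

  front-kind : ∀ z → z < 3 + (t + suc t) → Kind z
  front-kind 0 _ = isU
  front-kind 1 _ = isV
  front-kind 2 _ = isW₁
  front-kind (suc (suc (suc w))) (s≤s (s≤s (s≤s w<))) with w <? t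
  ... | yes w<t = inRestE w<t
  ... | no  w≮t with m≤n⇒∃[o]m+o≡n (≮⇒≥ w≮t)
  ...   | zero  , refl = subst Kind (cong (3 +_) (sym (+-identityʳ t))) isW′₁
  ...   | suc r , refl = inRestF (≤-pred (+-cancelˡ-< t (suc r) (suc t) w<))

  block-position : ∀ m {d} → d < m * T → ∃ λ i → ∃ λ r → i < m × r < T × i * T + r ≡ d
  block-position m {d} d< =
    d / T , d % T , m<n*o⇒m/o<n d< , m%n<n d T , trans (+-comm _ (d % T)) (sym (m≡m%n+[m/n]*n d T))

  blockA-kind : ∀ d → d < a * T → Kind (baseA + d)
  blockA-kind d d< with block-position a d<
  ... | i , r , i<a , r<T , refl = subst Kind (+-assoc baseA (i * T) r) (inBlockA (split< i<a) r<T)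

  blockB-kind : ∀ d → d < b * T → Kind (baseB + d)
  blockB-kind d d< with block-position b d<
  ... | j , r , j<b , r<T , refl = subst Kind (+-assoc baseB (j * T) r) (inBlockB (split< j<b) r<T)

  kind : ∀ z → z < n → Kind z
  kind z z<n with z <? baseA | z <? baseB
  ... | yes z<baseA | _ = front-kind z (subst (z <_) baseA≡ z<baseA)
  ... | no  z≮baseA | yes z<baseB with m≤n⇒∃[o]m+o≡n (≮⇒≥ z≮baseA)
  ...   | d , eq = subst Kind eq (blockA-kind d (+-cancelˡ-< baseA d (a * T) (subst (_< baseB) (sym eq) z<baseB)))
  kind z z<n | no _ | no z≮baseB with m≤n⇒∃[o]m+o≡n (≮⇒≥ z≮baseB)
  ...   | d , eq = subst Kind eq (blockB-kind d (+-cancelˡ-< baseB d (b * T) (subst (_< n) (sym eq) z<n)))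

  a≤len : a ≤ len
  a≤len = ≤-trans (m≤m+n a b) (n≤1+n _)

  1+a≤len : suc a ≤ len
  1+a≤len = s≤s (m≤m+n a b)

  2+a≤len : 2 + a ≤ len
  2+a≤len = s≤s (subst (suc a ≤_) (sym (+-suc a b′)) (s≤s (m≤m+n a b′)))

  Proper : Interval → Set
  Proper p = proj₁ p ≤ proj₂ p × proj₂ p ≤ suc (proj₁ p) × proj₂ p ≤ len

  proper-entry : ∀ {ps} → All Proper ps → ∀ z → Proper (entry ps z)
  proper-entry []           z       = z≤n , z≤n , z≤n
  proper-entry (pp ∷ _)     zero    = pp
  proper-entry (_  ∷ proper) (suc z) = proper-entry proper z

  proper-single : ∀ {s} → s ≤ len → Proper (s , s)
  proper-single {s} s≤len = ≤-refl , n≤1+n s , s≤len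

  proper-pair : ∀ {s} → suc s ≤ len → Proper (s , suc s)
  proper-pair {s} s<len = n≤1+n s , ≤-refl , s<len

  proper-blocksA : ∀ m → m ≤ a → All Proper (blocksA m)
  proper-blocksA zero    _   = []
  proper-blocksA (suc m) m<a = ++⁺ (proper-head m m≤len ∷ replicate⁺ (suc t) (proper-single m≤len))
                                    (proper-blocksA m (<⇒≤ m<a))
    where
    m≤len : m ≤ len
    m≤len = ≤-trans (<⇒≤ m<a) (≤-trans (m≤m+n a b) (n≤1+n _))
    proper-head : ∀ s → s ≤ len → Proper (pred s , s)
    proper-head zero    s≤len = z≤n , z≤n , s≤len
    proper-head (suc s) s≤len = proper-pair s≤len

  proper-blocksB : ∀ s r → r + s ≤ suc len → All Proper (blocksB s r)
  proper-blocksB s zero    _   = []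
  proper-blocksB s (suc r) r+s<len =
    ++⁺ (proper-first r (≤-pred r+s<len) ∷ replicate⁺ (suc t) (proper-single (≤-trans (m≤n+m s r) (≤-pred r+s<len))))
        (proper-blocksB (suc s) r (subst (_≤ suc len) (sym (+-suc r s)) r+s<len))
    where
    proper-first : ∀ r → r + s ≤ len → Proper (firstB s r)
    proper-first zero     s≤len   = proper-single s≤len
    proper-first (suc r′) r′+s<len = proper-pair (≤-trans (s≤s (m≤n+m s r′)) r′+s<len)

  proper-intervals : All Proper intervals
  proper-intervals =
    ++⁺ (proper-pair 1+a≤len ∷ proper-pair 1+a≤len ∷ proper-pair a≤len ∷
         ++⁺ (replicate⁺ t (proper-single a≤len))
             (proper-pair 2+a≤len ∷ replicate⁺ t (proper-single 1+a≤len)))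
        (++⁺ (proper-blocksA a ≤-refl) (proper-blocksB (2 + a) b b+2+a≤))
    where
    b+2+a≤ : b + (2 + a) ≤ suc len
    b+2+a≤ = ≤-reflexive (trans (+-suc b (suc a)) (cong suc (trans (+-suc b a) (cong suc (+-comm b a)))))

  lo≤hi : ∀ z → lo z ≤ hi z
  lo≤hi z = proj₁ (proper-entry proper-intervals z)

  hi≤1+lo : ∀ z → hi z ≤ suc (lo z)
  hi≤1+lo z = proj₁ (proj₂ (proper-entry proper-intervals z))

  hi≤len : ∀ z → hi z ≤ len
  hi≤len z = proj₂ (proj₂ (proper-entry proper-intervals z))

  -- (s ∸ a , a ∸ s) tells whether s lies left of a, at a, or right of a; so does (c ∸ a , a ∸ c)
  -- in jointAt below.
  edgeAt : ℕ → ℕ → List ℕ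
  edgeAt zero          zero    = edgeE
  edgeAt zero          (suc i) = pendantA i
  edgeAt (suc zero)    _       = edgeF
  edgeAt (suc (suc j)) _       = pendantB j

  spineEdge : ℕ → List ℕ
  spineEdge s = edgeAt (s ∸ a) (a ∸ s)

  left-of-a : ∀ {i s} → a ≡ i + suc s → s ∸ a ≡ 0 × a ∸ s ≡ suc i
  left-of-a {i} {s} a≡ = m≤n⇒m∸n≡0 (≤-trans (n≤1+n s) (subst (suc s ≤_) (sym a≡) (m≤n+m (suc s) i))) ,
                         trans (cong (_∸ s) (trans a≡ (+-suc i s))) (m+n∸n≡m (suc i) s)

  right-of-a : ∀ j → j + (2 + a) ∸ a ≡ 2 + j
  right-of-a j = trans (cong (_∸ a) (trans (+-suc j (suc a)) (cong suc (+-suc j a)))) (m+n∸n≡m (2 + j) a)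

  spineEdge-A : ∀ {i s} → a ≡ i + suc s → spineEdge s ≡ pendantA i
  spineEdge-A a≡ = cong₂ edgeAt (proj₁ (left-of-a a≡)) (proj₂ (left-of-a a≡))

  spineEdge-E : spineEdge a ≡ edgeE
  spineEdge-E = cong₂ edgeAt (n∸n≡0 a) (n∸n≡0 a)

  spineEdge-F : spineEdge (suc a) ≡ edgeF
  spineEdge-F = cong (λ d → edgeAt d (a ∸ suc a)) (m+n∸n≡m 1 a)

  spineEdge-B : ∀ j → spineEdge (j + (2 + a)) ≡ pendantB j
  spineEdge-B j = cong (λ d → edgeAt d (a ∸ (j + (2 + a)))) (right-of-a j)

  data SpinePlace : ℕ → Set where
    inA : ∀ {i s} → a ≡ i + suc s → SpinePlace s
    atE : SpinePlace a
    atF : SpinePlace (suc a)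
    inB : ∀ {j r′} → b ≡ j + suc r′ → SpinePlace (j + (2 + a))

  spinePlace : ∀ s → s ≤ len → SpinePlace s
  spinePlace s s≤len with s <? a | s ≟ a | s ≟ suc a
  ... | yes s<a | _      | _      = inA (sym (m∸n+n≡m s<a))
  ... | no  _   | yes refl | _    = atE
  ... | no  _   | no  _  | yes refl = atF
  ... | no  s≮a | no s≢a | no s≢1+a with m≤n⇒∃[o]m+o≡n 2+a≤s
    where
    2+a≤s : 2 + a ≤ s
    2+a≤s = ≤∧≢⇒< (≤∧≢⇒< (≮⇒≥ s≮a) (s≢a ∘ sym)) (s≢1+a ∘ sym)
  ...   | j , eq = subst SpinePlace (trans (+-comm j (2 + a)) eq)
                         (inB (split< (+-cancelˡ-< a j b (≤-pred (subst (_≤ len) (sym eq) s≤len)))))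

  B-index≤len : ∀ {j r′} → b ≡ j + suc r′ → j + (2 + a) ≤ len
  B-index≤len {j} {r′} b≡ = begin
    j + (2 + a)       ≡⟨ +-suc j (suc a) ⟩
    suc (j + suc a)   ≡⟨ cong suc (trans (+-suc j a) (cong suc (+-comm j a))) ⟩
    suc (suc (a + j)) ≡⟨ cong suc (sym (+-suc a j)) ⟩
    suc (a + suc j)   ≤⟨ s≤s (+-monoʳ-≤ a (subst (suc j ≤_) (sym b≡) (split⇒< (refl {x = j + suc r′})))) ⟩
    len               ∎
    where open ≤-Reasoning

  Ends : ℕ → Set
  Ends z = z ∈ spineEdge (lo z) × z ∈ spineEdge (hi z)

  ends : ∀ {z l h} → entry intervals z ≡ (l , h) → z ∈ spineEdge l → z ∈ spineEdge h → Ends z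
  ends {z} eq l∈ h∈ = subst (λ p → z ∈ spineEdge (proj₁ p) × z ∈ spineEdge (proj₂ p)) (sym eq) (l∈ , h∈)

  ∈E : ∀ {z} → z ∈ edgeE → z ∈ spineEdge a
  ∈E {z} = subst (z ∈_) (sym spineEdge-E)

  ∈F : ∀ {z} → z ∈ edgeF → z ∈ spineEdge (suc a)
  ∈F {z} = subst (z ∈_) (sym spineEdge-F)

  ∈A : ∀ i s {r} → a ≡ i + suc s → r < T → baseA + i * T + r ∈ spineEdge s
  ∈A i s {r} a≡ r<T = subst (baseA + i * T + r ∈_) (sym (spineEdge-A {i} {s} a≡)) (there (∈block _ T r<T))

  ∈B : ∀ j {r} → r < T → baseB + j * T + r ∈ spineEdge (j + (2 + a))
  ∈B j {r} r<T = subst (baseB + j * T + r ∈_) (sym (spineEdge-B j)) (there (∈block _ T r<T))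

  k∈F : k ∈ edgeF
  k∈F = there (there (subst (_∈ block k (suc t)) (+-identityʳ k) (∈block k (suc t) (s≤s z≤n))))

  ends-A : ∀ {i s} r → a ≡ i + suc s → r < T → Ends (baseA + i * T + r)
  ends-A {i} {s} (suc r) a≡ r<T =
    ends (trans (entry-A i s a≡ r<T) (entry-replicate (suc t) _ (≤-pred r<T))) (∈A i s a≡ r<T) (∈A i s a≡ r<T)
  ends-A {i} {zero}  zero a≡ r<T = ends (entry-A i 0 a≡ r<T) (∈A i 0 a≡ r<T) (∈A i 0 a≡ r<T)
  ends-A {i} {suc s} zero a≡ r<T =
    ends (entry-A i (suc s) a≡ r<T)
         (subst (baseA + i * T + 0 ∈_) (sym (spineEdge-A {suc i} {s} (trans a≡ (+-suc i (suc s)))))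
                (here (+-identityʳ _)))
         (∈A i (suc s) a≡ r<T)

  ends-B : ∀ {j r′} r → b ≡ j + suc r′ → r < T → Ends (baseB + j * T + r)
  ends-B {j} {r′} (suc r) b≡ r<T =
    ends (trans (entry-B j r′ b≡ r<T) (entry-replicate (suc t) _ (≤-pred r<T))) (∈B j r<T) (∈B j r<T)
  ends-B {j} {zero}   zero b≡ r<T = ends (entry-B j 0 b≡ r<T) (∈B j r<T) (∈B j r<T)
  ends-B {j} {suc r′} zero b≡ r<T =
    ends (entry-B j (suc r′) b≡ r<T) (∈B j r<T)
         (subst (baseB + j * T + 0 ∈_) (sym (spineEdge-B (suc j))) (here (+-identityʳ _)))

  vertex-ends : ∀ z → z < n → Ends z
  vertex-ends z z<n with kind z z<n
  ... | isU            = ∈E (here refl) , ∈F (here refl)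
  ... | isV            = ∈E (there (here refl)) , ∈F (there (here refl))
  ... | isW₁           = subst (2 ∈_) (sym (spineEdge-A {0} refl)) (here refl) ,
                         ∈E (there (there (∈block 2 (suc t) (s≤s z≤n))))
  ... | inRestE r<t    = ends (entry-restE r<t) ∈e ∈e
    where ∈e = ∈E (there (there (∈block 2 (suc t) (s≤s r<t))))
  ... | isW′₁          = ends entry-w′₁ (∈F k∈F) (subst (k ∈_) (sym (spineEdge-B 0)) (here refl))
  ... | inRestF r<t    = ends (entry-restF r<t) ∈f ∈f
    where ∈f = ∈F (there (there (∈block k (suc t) (s≤s r<t))))
  ... | inBlockA a≡ r<T = ends-A _ a≡ r<T
  ... | inBlockB b≡ r<T = ends-B _ b≡ r<T

  spineEdge∈edges : ∀ s → s ≤ len → spineEdge s ∈ edges H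
  spineEdge∈edges s s≤len with spinePlace s s≤len
  ... | inA a≡     = subst (_∈ edges H) (sym (spineEdge-A a≡)) (there (there (∈-++⁺ˡ (pendantA∈ (split⇒< a≡)))))
  ... | atE        = subst (_∈ edges H) (sym spineEdge-E) (here refl)
  ... | atF        = subst (_∈ edges H) (sym spineEdge-F) (there (here refl))
  ... | inB {j} b≡ = subst (_∈ edges H) (sym (spineEdge-B j))
                           (there (there (∈-++⁺ʳ (pendant k 2 baseA a) (pendantB∈ (split⇒< b≡)))))

  edges⊆spineEdges : ∀ e → e ∈ edges H → ∃ λ s → s ≤ len × e ≡ spineEdge s
  edges⊆spineEdges e (here refl)         = a , a≤len , sym spineEdge-E
  edges⊆spineEdges e (there (here refl)) = suc a , 1+a≤len , sym spineEdge-F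
  edges⊆spineEdges e (there (there e∈)) with ∈-++⁻ (pendant k 2 baseA a) e∈
  ... | inj₁ e∈A with pendantA∈⁻ e∈A
  ...   | i , i<a , refl = a ∸ suc i , ≤-trans (m∸n≤m a (suc i)) a≤len , sym (spineEdge-A (split< i<a))
  edges⊆spineEdges e (there (there e∈)) | inj₂ e∈B with pendantB∈⁻ e∈B
  ...   | j , j<b , refl = j + (2 + a) , B-index≤len (split< j<b) , sym (spineEdge-B j)

  bounds : ∀ z {l h s} → entry intervals z ≡ (l , h) → l ≤ s → s ≤ h → lo z ≤ s × s ≤ hi z
  bounds z {s = s} eq l≤s s≤h = subst (λ p → proj₁ p ≤ s × s ≤ proj₂ p) (sym eq) (l≤s , s≤h)

  entry-head : ∀ z → entry intervals (z + 0) ≡ entry intervals z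
  entry-head z = cong (entry intervals) (+-identityʳ z)

  edgeE-bounds : ∀ {z} → z ∈ edgeE → lo z ≤ a × a ≤ hi z
  edgeE-bounds (here refl)          = ≤-refl , n≤1+n a
  edgeE-bounds (there (here refl))  = ≤-refl , n≤1+n a
  edgeE-bounds (there (there z∈)) with ∈block⁻ 2 (suc t) z∈
  ... | zero  , _  , refl = n≤1+n a′ , ≤-refl
  ... | suc r , r< , refl = bounds (3 + r) (entry-restE (≤-pred r<)) ≤-refl ≤-refl

  edgeF-bounds : ∀ {z} → z ∈ edgeF → lo z ≤ suc a × suc a ≤ hi z
  edgeF-bounds (here refl)          = n≤1+n a , ≤-refl
  edgeF-bounds (there (here refl))  = n≤1+n a , ≤-refl
  edgeF-bounds (there (there z∈)) with ∈block⁻ k (suc t) z∈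
  ... | zero  , _  , refl = bounds (k + 0) (trans (entry-head k) entry-w′₁) ≤-refl (n≤1+n _)
  ... | suc r , r< , refl = bounds (k + suc r) (entry-restF (≤-pred r<)) ≤-refl ≤-refl

  pendantA-bounds : ∀ i s {z} → a ≡ i + suc s → z ∈ pendantA i → lo z ≤ s × s ≤ hi z
  pendantA-bounds zero     s refl (here refl) = ≤-refl , n≤1+n s
  pendantA-bounds (suc i)  s a≡   (here refl) =
    bounds (baseA + i * T)
           (trans (sym (entry-head (baseA + i * T))) (entry-A i (suc s) (trans a≡ (sym (+-suc i (suc s)))) (s≤s z≤n)))
           ≤-refl (n≤1+n s)
  pendantA-bounds i s a≡ (there z∈) with ∈block⁻ (baseA + i * T) T z∈
  ... | zero  , r<T , refl = bounds (baseA + i * T + 0) (entry-A i s a≡ r<T) pred[n]≤n ≤-refl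
  ... | suc r , r<T , refl =
    bounds (baseA + i * T + suc r) (trans (entry-A i s a≡ r<T) (entry-replicate (suc t) _ (≤-pred r<T))) ≤-refl ≤-refl

  pendantB-bounds : ∀ j r′ {z} → b ≡ j + suc r′ → z ∈ pendantB j → lo z ≤ j + (2 + a) × j + (2 + a) ≤ hi z
  pendantB-bounds zero    r′ b≡ (here refl) = bounds k entry-w′₁ (n≤1+n _) ≤-refl
  pendantB-bounds (suc j) r′ b≡ (here refl) =
    bounds (baseB + j * T)
           (trans (sym (entry-head (baseB + j * T))) (entry-B j (suc r′) (trans b≡ (sym (+-suc j (suc r′)))) (s≤s z≤n)))
           (n≤1+n _) ≤-refl
  pendantB-bounds j r′ b≡ (there z∈) with ∈block⁻ (baseB + j * T) T z∈
  ... | suc r , r<T , refl =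
    bounds (baseB + j * T + suc r) (trans (entry-B j r′ b≡ r<T) (entry-replicate (suc t) _ (≤-pred r<T))) ≤-refl ≤-refl
  ... | zero  , r<T , refl with r′
  ...   | zero    = bounds (baseB + j * T + 0) (entry-B j 0 b≡ r<T) ≤-refl ≤-refl
  ...   | suc r″  = bounds (baseB + j * T + 0) (entry-B j (suc r″) b≡ r<T) ≤-refl (n≤1+n _)

  spineEdge-bounds : ∀ s → s ≤ len → ∀ z → z ∈ spineEdge s → lo z ≤ s × s ≤ hi z
  spineEdge-bounds s s≤len z z∈ with spinePlace s s≤len
  ... | inA {i} a≡      = pendantA-bounds i s a≡ (subst (z ∈_) (spineEdge-A a≡) z∈)
  ... | atE             = edgeE-bounds (subst (z ∈_) spineEdge-E z∈)
  ... | atF             = edgeF-bounds (subst (z ∈_) spineEdge-F z∈)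
  ... | inB {j} {r′} b≡ = pendantB-bounds j r′ b≡ (subst (z ∈_) (spineEdge-B j) z∈)

  baseA≤n : baseA ≤ n
  baseA≤n = ≤-trans (m≤m+n baseA (a * T)) (m≤m+n baseB (b * T))

  front-vertex<n : ∀ {z} → z ≤ 3 + t → z < n
  front-vertex<n z≤ = ≤-trans (s≤s z≤) (≤-trans (subst (4 + t ≤_) (sym baseA≡) (s≤s (s≤s (s≤s (m≤n+m (suc t) t)))))
                                               baseA≤n)

  blockA-vertex<n : ∀ {i s r} → a ≡ i + suc s → r < T → baseA + i * T + r < n
  blockA-vertex<n {i} {s} {r} a≡ r<T =
    <-≤-trans (subst (_< baseA + a * T) (sym (+-assoc baseA (i * T) r))
                     (+-monoʳ-< baseA (block-offset< (split⇒< a≡) r<T)))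
              (m≤m+n baseB (b * T))

  blockB-vertex<n : ∀ {j r′ r} → b ≡ j + suc r′ → r < T → baseB + j * T + r < n
  blockB-vertex<n {j} {r′} {r} b≡ r<T =
    subst (_< n) (sym (+-assoc baseB (j * T) r)) (+-monoʳ-< baseB (block-offset< (split⇒< b≡) r<T))

  last-B-index : ∀ {j} → b ≡ j + 1 → j + (2 + a) ≡ len
  last-B-index {j} b≡ = trans (shape j a) (cong (λ m → suc (a + m)) (sym b≡))
    where
    shape : ∀ j a → j + (2 + a) ≡ suc (a + (j + 1))
    shape = solve-∀

  jointAt : ℕ → ℕ → ℕ
  jointAt zero          zero          = 0
  jointAt zero          (suc zero)    = 2
  jointAt zero          (suc (suc i)) = baseA + i * T
  jointAt (suc zero)    _             = k
  jointAt (suc (suc j)) _             = baseB + j * T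

  joint : ℕ → ℕ
  joint c = jointAt (c ∸ a) (a ∸ c)

  IsJoint : ℕ → ℕ → Set
  IsJoint c w = w < n × lo w ≡ c × hi w ≡ suc c

  jointAt-A : ∀ i {c} → a ≡ i + suc c → IsJoint c (jointAt 0 (suc i))
  jointAt-A zero    refl = front-vertex<n (s≤s (s≤s z≤n)) , refl , refl
  jointAt-A (suc i) {c} a≡ =
    subst (IsJoint c) (+-identityʳ (baseA + i * T))
          (blockA-vertex<n a≡′ (s≤s z≤n) , cong proj₁ entry≡ , cong proj₂ entry≡)
    where
    a≡′ : a ≡ i + suc (suc c)
    a≡′ = trans a≡ (sym (+-suc i (suc c)))
    entry≡ : entry intervals (baseA + i * T + 0) ≡ (c , suc c)
    entry≡ = entry-A i (suc c) a≡′ (s≤s z≤n)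

  jointAt-B : ∀ j r′ → b ≡ j + suc r′ → j + (2 + a) < len → IsJoint (j + (2 + a)) (baseB + j * T)
  jointAt-B j zero     b≡ c<len = ⊥-elim (<-irrefl (last-B-index b≡) c<len)
  jointAt-B j (suc r′) b≡ c<len =
    subst (IsJoint (j + (2 + a))) (+-identityʳ (baseB + j * T))
          (blockB-vertex<n b≡ (s≤s z≤n) , cong proj₁ entry≡ , cong proj₂ entry≡)
    where
    entry≡ : entry intervals (baseB + j * T + 0) ≡ (j + (2 + a) , suc (j + (2 + a)))
    entry≡ = entry-B j (suc r′) b≡ (s≤s z≤n)

  joint-spec : ∀ c → c < len → IsJoint c (joint c)
  joint-spec c c<len with spinePlace c (<⇒≤ c<len)
  ... | inA {i} a≡ = subst (IsJoint c) (sym (cong₂ jointAt (proj₁ (left-of-a a≡)) (proj₂ (left-of-a a≡))))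
                           (jointAt-A i a≡)
  ... | atE        = subst (IsJoint a) (sym (cong₂ jointAt (n∸n≡0 a) (n∸n≡0 a)))
                           (front-vertex<n z≤n , refl , refl)
  ... | atF        = subst (IsJoint (suc a)) (sym (cong (λ d → jointAt d (a ∸ suc a)) (m+n∸n≡m 1 a)))
                           (front-vertex<n ≤-refl , cong proj₁ entry-w′₁ , cong proj₂ entry-w′₁)
  ... | inB {j} {r′} b≡ = subst (IsJoint (j + (2 + a)))
                                (sym (cong (λ d → jointAt d (a ∸ (j + (2 + a)))) (right-of-a j)))
                                (jointAt-B j r′ b≡ c<len)

  lastVertex : ℕ
  lastVertex = baseB + b′ * T + 1

  lastVertex-spec : lastVertex < n × lo lastVertex ≡ len
  lastVertex-spec = blockB-vertex<n b≡ (s≤s (s≤s z≤n)) ,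
                    trans (cong proj₁ (entry-B b′ 0 b≡ (s≤s (s≤s z≤n)))) (last-B-index b≡)
    where
    b≡ : b ≡ b′ + 1
    b≡ = sym (+-comm b′ 1)

  anchor : ∀ s → s ≤ len → ∃ λ w → w < n × lo w ≡ s
  anchor s s≤len with s <? len
  ... | yes s<len = joint s , proj₁ (joint-spec s s<len) , proj₁ (proj₂ (joint-spec s s<len))
  ... | no  s≮len = lastVertex , proj₁ lastVertex-spec , trans (proj₂ lastVertex-spec) (≤-antisym (≮⇒≥ s≮len) s≤len)

  spine : Spine H
  spine = record
    { len = len ; edge = spineEdge ; lo = lo ; hi = hi
    ; lo≤hi = lo≤hi ; hi≤1+lo = hi≤1+lo ; hi≤len = hi≤len
    ; lo∈edge = λ z z<n → proj₁ (vertex-ends z z<n)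
    ; hi∈edge = λ z z<n → proj₂ (vertex-ends z z<n)
    ; ∈edge⇒lo≤∧≤hi = spineEdge-bounds
    ; edge∈edges = spineEdge∈edges
    ; edges⊆spine = edges⊆spineEdges
    ; anchor = anchor
    ; joint = joint
    ; joint-spec = joint-spec
    }

  open SpineDistance spine public
    using (spineDistance; spineDistance-transmission; transmission-formula; left; right; across)

  length-intervals : length intervals ≡ n
  length-intervals = begin
    length (frontIntervals ++ blocksA a ++ blocksB (2 + a) b)
      ≡⟨ length-++ frontIntervals ⟩
    length frontIntervals + length (blocksA a ++ blocksB (2 + a) b)
      ≡⟨ cong (length frontIntervals +_) (length-++ (blocksA a)) ⟩
    length frontIntervals + (length (blocksA a) + length (blocksB (2 + a) b))
      ≡⟨ cong₂ (λ u v → u + v) length-front (cong₂ _+_ (length-blocksA a) (length-blocksB (2 + a) b)) ⟩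
    baseA + (a * T + b * T)
      ≡⟨ sym (+-assoc baseA (a * T) (b * T)) ⟩
    n ∎
    where open ≡-Reasoning

  rowSum-vertices : ∀ (g : Interval → ℕ) → rowSum n (g ∘ entry intervals) ≡
    sum (map g frontIntervals) + (sum (map g (blocksA a)) + sum (map g (blocksB (2 + a) b)))
  rowSum-vertices g = begin
    rowSum n (g ∘ entry intervals)
      ≡⟨ cong (λ m → rowSum m (g ∘ entry intervals)) (sym length-intervals) ⟩
    rowSum (length intervals) (g ∘ entry intervals)
      ≡⟨ rowSum-entry intervals g ⟩
    sum (map g intervals)
      ≡⟨ sum-map-++ g frontIntervals _ ⟩
    sum (map g frontIntervals) + sum (map g (blocksA a ++ blocksB (2 + a) b))
      ≡⟨ cong (sum (map g frontIntervals) +_) (sum-map-++ g (blocksA a) _) ⟩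
    sum (map g frontIntervals) + (sum (map g (blocksA a)) + sum (map g (blocksB (2 + a) b))) ∎
    where open ≡-Reasoning

  sum-front : ∀ (g : Interval → ℕ) → sum (map g frontIntervals) ≡
    g (a , suc a) + (g (a , suc a) + (g (a′ , a) + (t * g (a , a) + (g (suc a , 2 + a) + t * g (suc a , suc a)))))
  sum-front g = cong (λ m → g (a , suc a) + (g (a , suc a) + (g (a′ , a) + m))) (begin
    sum (map g (replicate t (a , a) ++ intervalsF))
      ≡⟨ sum-map-++ g (replicate t (a , a)) intervalsF ⟩
    sum (map g (replicate t (a , a))) + (g (suc a , 2 + a) + sum (map g (replicate t (suc a , suc a))))
      ≡⟨ cong₂ (λ u v → u + (g (suc a , 2 + a) + v))
               (sum-map-replicate g t (a , a)) (sum-map-replicate g t (suc a , suc a)) ⟩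
    t * g (a , a) + (g (suc a , 2 + a) + t * g (suc a , suc a)) ∎)
    where open ≡-Reasoning

  sum-block : ∀ (g : Interval → ℕ) p q → sum (map g (p ∷ replicate (suc t) q)) ≡ g p + suc t * g q
  sum-block g p q = cong (g p +_) (sum-map-replicate g (suc t) q)

  atHi : ℕ → Interval → ℕ
  atHi j p = ⟦ proj₂ p ≡ j ⟧

  sum-blocksA-atHi : ∀ j m → sum (map (atHi j) (blocksA m)) ≡ T * ⟦ j < m ⟧
  sum-blocksA-atHi j zero    = sym (*-zeroʳ T)
  sum-blocksA-atHi j (suc m) = begin
    sum (map (atHi j) (blockA m ++ blocksA m))
      ≡⟨ sum-map-++ (atHi j) (blockA m) (blocksA m) ⟩
    sum (map (atHi j) (blockA m)) + sum (map (atHi j) (blocksA m))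
      ≡⟨ cong₂ _+_ (sum-block (atHi j) (pred m , m) (m , m)) (sum-blocksA-atHi j m) ⟩
    T * ⟦ m ≡ j ⟧ + T * ⟦ j < m ⟧
      ≡⟨ sym (*-distribˡ-+ T ⟦ m ≡ j ⟧ ⟦ j < m ⟧) ⟩
    T * (⟦ m ≡ j ⟧ + ⟦ j < m ⟧)
      ≡⟨ cong (λ e → T * (e + ⟦ j < m ⟧)) (⟦≡⟧-sym m j) ⟩
    T * (⟦ j ≡ m ⟧ + ⟦ j < m ⟧)
      ≡⟨ cong (T *_) (sym (⟦≤⟧≡⟦≡⟧+⟦<⟧ j m)) ⟩
    T * ⟦ j < suc m ⟧ ∎
    where open ≡-Reasoning

  sum-blocksB-atHi : ∀ j s r → suc j < s + r → sum (map (atHi j) (blocksB s r)) + ⟦ s ≡ j ⟧ ≡ T * ⟦ s ≤ j ⟧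
  sum-blocksB-atHi j s zero j+1<s =
    trans (⟦≡⟧-false (>⇒≢ j<s)) (sym (trans (cong (T *_) (⟦≤⟧-false j<s)) (*-zeroʳ T)))
    where
    j<s : j < s
    j<s = <-trans (n<1+n j) (subst (suc j <_) (+-identityʳ s) j+1<s)
  sum-blocksB-atHi j s (suc zero) j+1<s+1 = begin
    sum (map (atHi j) (blockB s 0 ++ [])) + ⟦ s ≡ j ⟧
      ≡⟨ cong (_+ ⟦ s ≡ j ⟧)
              (trans (sum-map-++ (atHi j) (blockB s 0) []) (cong (_+ 0) (sum-block (atHi j) (s , s) (s , s)))) ⟩
    T * ⟦ s ≡ j ⟧ + 0 + ⟦ s ≡ j ⟧
      ≡⟨ cong (λ e → T * e + 0 + e) (⟦≡⟧-false (>⇒≢ j<s)) ⟩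
    T * 0 + 0 + 0
      ≡⟨ trans (+-identityʳ _) (+-identityʳ _) ⟩
    T * 0
      ≡⟨ cong (T *_) (sym (⟦≤⟧-false j<s)) ⟩
    T * ⟦ s ≤ j ⟧ ∎
    where
    open ≡-Reasoning
    j<s : j < s
    j<s = ≤-pred (subst (suc j <_) (+-comm s 1) j+1<s+1)
  sum-blocksB-atHi j s (suc (suc r)) j+1<s+r = begin
    sum (map (atHi j) (blockB s (suc r) ++ blocksB (suc s) (suc r))) + ⟦ s ≡ j ⟧
      ≡⟨ cong (_+ ⟦ s ≡ j ⟧) (sum-map-++ (atHi j) (blockB s (suc r)) (blocksB (suc s) (suc r))) ⟩
    sum (map (atHi j) (blockB s (suc r))) + rest + ⟦ s ≡ j ⟧
      ≡⟨ cong (λ m → m + rest + ⟦ s ≡ j ⟧) (sum-block (atHi j) (s , suc s) (s , s)) ⟩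
    ⟦ suc s ≡ j ⟧ + suc t * ⟦ s ≡ j ⟧ + rest + ⟦ s ≡ j ⟧
      ≡⟨ regroup ⟦ suc s ≡ j ⟧ ⟦ s ≡ j ⟧ rest t ⟩
    T * ⟦ s ≡ j ⟧ + (rest + ⟦ suc s ≡ j ⟧)
      ≡⟨ cong (T * ⟦ s ≡ j ⟧ +_) (sum-blocksB-atHi j (suc s) (suc r) (subst (suc j <_) (+-suc s (suc r)) j+1<s+r)) ⟩
    T * ⟦ s ≡ j ⟧ + T * ⟦ suc s ≤ j ⟧
      ≡⟨ sym (*-distribˡ-+ T ⟦ s ≡ j ⟧ ⟦ suc s ≤ j ⟧) ⟩
    T * (⟦ s ≡ j ⟧ + ⟦ s < j ⟧)
      ≡⟨ cong (T *_) (sym (⟦≤⟧≡⟦≡⟧+⟦<⟧ s j)) ⟩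
    T * ⟦ s ≤ j ⟧ ∎
    where
    open ≡-Reasoning
    rest : ℕ
    rest = sum (map (atHi j) (blocksB (suc s) (suc r)))
    regroup : ∀ x y z t → x + suc t * y + z + y ≡ (2 + t) * y + (z + x)
    regroup = solve-∀

  hiCount : ℕ → ℕ
  hiCount j = rowSum n (λ x → ⟦ hi x ≡ j ⟧)

  -- Every spine edge contributes k − 1 vertices whose last edge it is, except that u and v
  -- (lying in e and f) move one vertex from e to f.
  hiCount+⟦a≡⟧ : ∀ j → j < len → hiCount j + ⟦ a ≡ j ⟧ ≡ T
  hiCount+⟦a≡⟧ j j<len = begin
    hiCount j + A
      ≡⟨ cong (_+ A) (rowSum-vertices (atHi j)) ⟩
    sum (map (atHi j) frontIntervals) + (sum (map (atHi j) (blocksA a)) + SB) + A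
      ≡⟨ cong₂ (λ u v → u + (v + SB) + A) (sum-front (atHi j)) (sum-blocksA-atHi j a) ⟩
    (B + (B + (A + (t * A + (C + t * B))))) + (T * X + SB) + A
      ≡⟨ regroup t A B C X SB ⟩
    T * (A + B + X) + (SB + C)
      ≡⟨ cong (T * (A + B + X) +_) (sum-blocksB-atHi j (2 + a) b (s≤s j<len)) ⟩
    T * (A + B + X) + T * Z
      ≡⟨ factor t A B X Z ⟩
    T * ((A + (B + Z)) + X)
      ≡⟨ cong (λ m → T * (m + X)) (trans (cong (A +_) (sym (⟦≤⟧≡⟦≡⟧+⟦<⟧ (suc a) j))) (sym (⟦≤⟧≡⟦≡⟧+⟦<⟧ a j))) ⟩
    T * (⟦ a ≤ j ⟧ + ⟦ j < a ⟧)
      ≡⟨ cong (T *_) (⟦≤⟧+⟦>⟧≡1 a j) ⟩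
    T * 1
      ≡⟨ *-identityʳ T ⟩
    T ∎
    where
    open ≡-Reasoning
    A B C X Z SB : ℕ
    A = ⟦ a ≡ j ⟧
    B = ⟦ suc a ≡ j ⟧
    C = ⟦ 2 + a ≡ j ⟧
    X = ⟦ j < a ⟧
    Z = ⟦ 2 + a ≤ j ⟧
    SB = sum (map (atHi j) (blocksB (2 + a) b))
    regroup : ∀ t A B C X SB → (B + (B + (A + (t * A + (C + t * B))))) + ((2 + t) * X + SB) + A ≡
                               (2 + t) * (A + B + X) + (SB + C)
    regroup = solve-∀
    factor : ∀ t A B X Z → (2 + t) * (A + B + X) + (2 + t) * Z ≡ (2 + t) * ((A + (B + Z)) + X)
    factor = solve-∀

  atCut : ℕ → Interval → ℕ
  atCut c p = ⟦ proj₁ p ≤ c ⟧ * ⟦ c < proj₂ p ⟧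

  sum-block-atCut : ∀ c p s → sum (map (atCut c) (p ∷ replicate (suc t) (s , s))) ≡ atCut c p
  sum-block-atCut c p s = begin
    sum (map (atCut c) (p ∷ replicate (suc t) (s , s))) ≡⟨ sum-block (atCut c) p (s , s) ⟩
    atCut c p + suc t * atCut c (s , s)                  ≡⟨ cong (λ x → atCut c p + suc t * x) (⟦≤⟧*⟦>⟧≡0 s c) ⟩
    atCut c p + suc t * 0                                ≡⟨ cong (atCut c p +_) (*-zeroʳ (suc t)) ⟩
    atCut c p + 0                                        ≡⟨ +-identityʳ (atCut c p) ⟩
    atCut c p                                            ∎
    where open ≡-Reasoning

  sum-blocksA-atCut : ∀ c m → sum (map (atCut c) (blocksA m)) ≡ ⟦ suc c < m ⟧
  sum-blocksA-atCut c zero          = refl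
  sum-blocksA-atCut c (suc zero)    = trans (sum-map-++ (atCut c) (blockA 0) [])
    (trans (+-identityʳ _) (trans (sum-block-atCut c (0 , 0) 0) (⟦≤⟧*⟦>⟧≡0 0 c)))
  sum-blocksA-atCut c (suc (suc m)) = begin
    sum (map (atCut c) (blockA (suc m) ++ blocksA (suc m)))
      ≡⟨ sum-map-++ (atCut c) (blockA (suc m)) (blocksA (suc m)) ⟩
    sum (map (atCut c) (blockA (suc m))) + sum (map (atCut c) (blocksA (suc m)))
      ≡⟨ cong₂ _+_ (trans (sum-block-atCut c (m , suc m) (suc m)) (⟦≤⟧*⟦<suc⟧≡⟦≡⟧ m c))
                   (sum-blocksA-atCut c (suc m)) ⟩
    ⟦ m ≡ c ⟧ + ⟦ c < m ⟧
      ≡⟨ cong (_+ ⟦ c < m ⟧) (⟦≡⟧-sym m c) ⟩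
    ⟦ c ≡ m ⟧ + ⟦ c < m ⟧
      ≡⟨ sym (⟦≤⟧≡⟦≡⟧+⟦<⟧ c m) ⟩
    ⟦ c ≤ m ⟧ ∎
    where open ≡-Reasoning

  sum-blocksB-atCut : ∀ c s r → suc c < s + r → sum (map (atCut c) (blocksB s r)) ≡ ⟦ s ≤ c ⟧
  sum-blocksB-atCut c s zero c+1<s =
    sym (⟦≤⟧-false (<-trans (n<1+n c) (subst (suc c <_) (+-identityʳ s) c+1<s)))
  sum-blocksB-atCut c s (suc zero) c+1<s+1 =
    trans (sum-map-++ (atCut c) (blockB s 0) []) (trans (+-identityʳ _) (trans (sum-block-atCut c (s , s) s)
      (trans (⟦≤⟧*⟦>⟧≡0 s c) (sym (⟦≤⟧-false (≤-pred (subst (suc c <_) (+-comm s 1) c+1<s+1)))))))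
  sum-blocksB-atCut c s (suc (suc r)) c+1<s+r = begin
    sum (map (atCut c) (blockB s (suc r) ++ blocksB (suc s) (suc r)))
      ≡⟨ sum-map-++ (atCut c) (blockB s (suc r)) (blocksB (suc s) (suc r)) ⟩
    sum (map (atCut c) (blockB s (suc r))) + sum (map (atCut c) (blocksB (suc s) (suc r)))
      ≡⟨ cong₂ _+_ (trans (sum-block-atCut c (s , suc s) s) (⟦≤⟧*⟦<suc⟧≡⟦≡⟧ s c))
                   (sum-blocksB-atCut c (suc s) (suc r) (subst (suc c <_) (+-suc s (suc r)) c+1<s+r)) ⟩
    ⟦ s ≡ c ⟧ + ⟦ s < c ⟧
      ≡⟨ sym (⟦≤⟧≡⟦≡⟧+⟦<⟧ s c) ⟩
    ⟦ s ≤ c ⟧ ∎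
    where open ≡-Reasoning

  -- Only the cut between e and f is crossed by two vertices (u and v); every other cut by one joint.
  across≡ : ∀ c → c < len → across c ≡ suc ⟦ a ≡ c ⟧
  across≡ c c<len = begin
    across c
      ≡⟨ rowSum-vertices (atCut c) ⟩
    sum (map (atCut c) frontIntervals) + (sum (map (atCut c) (blocksA a)) + sum (map (atCut c) (blocksB (2 + a) b)))
      ≡⟨ cong₂ _+_ front (cong₂ _+_ (sum-blocksA-atCut c a) (sum-blocksB-atCut c (2 + a) b (s≤s c<len))) ⟩
    E + (E + (E′ + (t * 0 + (F + t * 0)))) + (P + Q)
      ≡⟨ regroup E E′ F P Q t ⟩
    E + ((E′ + (E + (F + Q))) + P)
      ≡⟨ cong (λ m → E + (m + P)) (trans (cong (λ m → E′ + (E + m)) (sym (⟦≤⟧≡⟦≡⟧+⟦<⟧ (suc a) c)))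
                                   (trans (cong (E′ +_) (sym (⟦≤⟧≡⟦≡⟧+⟦<⟧ a c))) (sym (⟦≤⟧≡⟦≡⟧+⟦<⟧ a′ c)))) ⟩
    E + (⟦ a′ ≤ c ⟧ + ⟦ c < a′ ⟧)
      ≡⟨ cong (E +_) (⟦≤⟧+⟦>⟧≡1 a′ c) ⟩
    E + 1
      ≡⟨ +-comm E 1 ⟩
    suc E ∎
    where
    open ≡-Reasoning
    E E′ F P Q : ℕ
    E  = ⟦ a ≡ c ⟧
    E′ = ⟦ a′ ≡ c ⟧
    F  = ⟦ suc a ≡ c ⟧
    P  = ⟦ suc c < a ⟧
    Q  = ⟦ 2 + a ≤ c ⟧
    front : sum (map (atCut c) frontIntervals) ≡ E + (E + (E′ + (t * 0 + (F + t * 0))))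
    front = trans (sum-front (atCut c))
      (cong₂ (λ u v → u + (u + v)) (⟦≤⟧*⟦<suc⟧≡⟦≡⟧ a c)
        (cong₂ _+_ (⟦≤⟧*⟦<suc⟧≡⟦≡⟧ a′ c)
          (cong₂ (λ u v → t * u + v) (⟦≤⟧*⟦>⟧≡0 a c)
            (cong₂ (λ u v → u + t * v) (⟦≤⟧*⟦<suc⟧≡⟦≡⟧ (suc a) c) (⟦≤⟧*⟦>⟧≡0 (suc a) c)))))
    regroup : ∀ E E′ F P Q t → E + (E + (E′ + (t * 0 + (F + t * 0)))) + (P + Q) ≡ E + ((E′ + (E + (F + Q))) + P)
    regroup = solve-∀

  left-suc : ∀ c → left (suc c) ≡ left c + hiCount (suc c)
  left-suc c = trans (rowSum-cong n (λ x _ → ⟦≤suc⟧ (hi x) c))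
                     (rowSum-+ n (λ x → ⟦ hi x ≤ c ⟧) (λ x → ⟦ hi x ≡ suc c ⟧))

  left+⟦a≤⟧ : ∀ c → c < len → left c + ⟦ a ≤ c ⟧ ≡ suc c * T
  left+⟦a≤⟧ zero    0<len = begin
    left 0 + 0        ≡⟨ cong (_+ 0) (rowSum-cong n (λ x _ → ⟦≤0⟧ (hi x))) ⟩
    hiCount 0 + 0     ≡⟨ hiCount+⟦a≡⟧ 0 0<len ⟩
    T                 ≡⟨ sym (+-identityʳ T) ⟩
    1 * T             ∎
    where open ≡-Reasoning
  left+⟦a≤⟧ (suc c) c+1<len = begin
    left (suc c) + ⟦ a ≤ suc c ⟧
      ≡⟨ cong₂ _+_ (left-suc c) (⟦≤suc⟧ a c) ⟩
    (left c + hiCount (suc c)) + (⟦ a ≤ c ⟧ + ⟦ a ≡ suc c ⟧)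
      ≡⟨ interchange (left c) (hiCount (suc c)) ⟦ a ≤ c ⟧ ⟦ a ≡ suc c ⟧ ⟩
    (left c + ⟦ a ≤ c ⟧) + (hiCount (suc c) + ⟦ a ≡ suc c ⟧)
      ≡⟨ cong₂ _+_ (left+⟦a≤⟧ c (<-trans (n<1+n c) c+1<len)) (hiCount+⟦a≡⟧ (suc c) c+1<len) ⟩
    suc c * T + T
      ≡⟨ +-comm (suc c * T) T ⟩
    suc (suc c) * T ∎
    where open ≡-Reasoning

  right+⟦≤a⟧ : ∀ c → c < len → right c + ⟦ c ≤ a ⟧ + suc c * T ≡ n
  right+⟦≤a⟧ c c<len = begin
    right c + ⟦ c ≤ a ⟧ + suc c * T
      ≡⟨ cong (right c + ⟦ c ≤ a ⟧ +_) (sym (left+⟦a≤⟧ c c<len)) ⟩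
    right c + ⟦ c ≤ a ⟧ + (left c + ⟦ a ≤ c ⟧)
      ≡⟨ regroup (right c) ⟦ c ≤ a ⟧ (left c) ⟦ a ≤ c ⟧ ⟩
    left c + (⟦ a ≤ c ⟧ + ⟦ c ≤ a ⟧) + right c
      ≡⟨ cong (λ m → left c + m + right c) (trans (⟦≤⟧+⟦≥⟧≡1+⟦≡⟧ a c) (sym (across≡ c c<len))) ⟩
    left c + across c + right c
      ≡⟨ SpineDistance.left+across+right spine c ⟩
    n ∎
    where
    open ≡-Reasoning
    regroup : ∀ R x L y → R + x + (L + y) ≡ L + (y + x) + R
    regroup = solve-∀

  n≡ : n ≡ suc len * T
  n≡ = trans (cong (λ m → m + a * T + b * T) baseA≡) (shape t a b)
    where
    shape : ∀ t x y → 3 + (t + suc t) + x * (2 + t) + y * (2 + t) ≡ (2 + (x + y)) * (2 + t)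
    shape = solve-∀

  σ : ℕ
  σ = pairSum n spineDistance

  cutProfile : CutProfile len T a left right
  cutProfile = record { left-eq = left+⟦a≤⟧ ; right-eq = λ c c<len → trans (right+⟦≤a⟧ c c<len) n≡ }


_<σ_ : Hypergraph → Hypergraph → Set
G <σ H = Σ ℕ λ s₁ → Σ ℕ λ s₂ → IsTransmission H s₁ × IsTransmission G s₂ × s₂ < s₁

shift-<σ : ∀ t a′ b″ → a′ < b″ → Ctilde (3 + t) (suc a′) (2 + b″) <σ Ctilde (3 + t) (2 + a′) (suc b″)
shift-<σ t a′ b″ a′<b″ = B.σ , S.σ , B.spineDistance-transmission , S.spineDistance-transmission , σS<σB
  where
  module S = CtildeSpine t a′ (suc b″)
  module B = CtildeSpine t (suc a′) b″
  len≡ : S.len ≡ B.len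
  len≡ = cong suc (+-suc (suc a′) (suc b″))
  n≡ : S.n ≡ B.n
  n≡ = trans S.n≡ (trans (cong (λ l → suc l * S.T) len≡) (sym B.n≡))
  room : suc a′ + (2 + suc a′) < B.len
  room = subst (_< B.len) (sym (shape a′)) (s≤s (s≤s (s≤s (+-monoʳ-< a′ (s≤s a′<b″)))))
    where
    shape : ∀ a′ → suc a′ + (2 + suc a′) ≡ 3 + (a′ + suc a′)
    shape = solve-∀
  S-profile : CutProfile B.len S.T S.a S.left S.right
  S-profile = subst (λ l → CutProfile l S.T S.a S.left S.right) len≡ S.cutProfile
  σS<σB : S.σ < B.σ
  σS<σB = begin-strict
    S.σ
      ≡⟨ S.transmission-formula ⟩
    pairSum S.n (λ _ _ → 1) + rowSum S.len (λ c → S.left c * S.right c)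
      ≡⟨ cong₂ (λ n l → pairSum n (λ _ _ → 1) + rowSum l (λ c → S.left c * S.right c)) n≡ len≡ ⟩
    pairSum B.n (λ _ _ → 1) + rowSum B.len (λ c → S.left c * S.right c)
      <⟨ +-monoʳ-< (pairSum B.n (λ _ _ → 1)) (CutComparison.Σcut-products-< S-profile B.cutProfile room) ⟩
    pairSum B.n (λ _ _ → 1) + rowSum B.len (λ c → B.left c * B.right c)
      ≡⟨ sym B.transmission-formula ⟩
    B.σ ∎
    where open ≤-Reasoning

lemma3p4 : (k m p q : ℕ) → 3 ≤ k → 4 ≤ m → 1 ≤ p → p + 2 ≤ q → p + q + 2 ≡ m
    → Σ ℕ λ s₁ → Σ ℕ λ s₂ →
    IsTransmission (Ctilde k (p + 1) (q ∸ 1)) s₁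
    × IsTransmission (Ctilde k p q) s₂
    × s₂ < s₁
-- m = p + q + 2 merely names the size.
lemma3p4 k m p q 3≤k _ 1≤p p+2≤q _
  with m≤n⇒∃[o]m+o≡n 3≤k | m≤n⇒∃[o]m+o≡n 1≤p | m≤n⇒∃[o]m+o≡n p+2≤q
... | t , refl | a′ , refl | d , refl =
  subst₂ (λ x y → Ctilde (3 + t) (suc a′) (suc y) <σ Ctilde (3 + t) x y)
         (cong suc (+-comm 1 a′)) (sym (shape a′ d))
         (shift-<σ t a′ (suc (a′ + d)) (s≤s (m≤m+n a′ d)))
  where
  shape : ∀ a′ d → a′ + 2 + d ≡ 2 + (a′ + d)
  shape = solve-∀
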